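{- Let $\lambda$ be a nonempty partition and $\mathrm{SYT}(\lambda)^{\mathrm{maj}}(q)=\sum_{T\in\mathrm{SYT}(\lambda)}q^{\mathrm{maj}(T)}$. The coefficient of $q^{b(\lambda)+1}$ in $\mathrm{SYT}(\lambda)^{\mathrm{maj}}(q)$ is $0$ if and only if $\lambda$ is a rectangle. If $\lambda$ is a rectangle with more than one row and more than one column, then the coefficient of $q^{b(\lambda)+2}$ in $\mathrm{SYT}(\lambda)^{\mathrm{maj}}(q)$ equals $1$.
   Context: $\mathrm{SYT}(\lambda)$: standard Young tableaux of shape $\lambda$ (English notation). $i$ is a descent of $T$ if $i+1$ lies in a strictly lower row; $\mathrm{maj}(T)$ is the sum of descents. $b(\lambda)=\sum_i(i-1)\lambda_i$. A rectangle is a partition all of whose nonzero parts are equal. -}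

module Defs where

open import Data.Nat using (ℕ; zero; suc; _+_; _*_; _∸_; _<_; _≥_; _≡ᵇ_; _<ᵇ_)
open import Data.Bool using (Bool; true; false; if_then_else_)
open import Data.List using (List; []; _∷_; map; length; concat; zip; applyUpTo)
open import Data.Nat.ListAction using (sum)
open import Data.Bool.ListAction using (any)
open import Data.List.Relation.Unary.All using (All)
open import Data.List.Relation.Unary.Linked using (Linked)
open import Data.List.Relation.Binary.Permutation.Propositional using (_↭_)
open import Data.Product using (_×_; uncurry)
open import Relation.Binary.PropositionalEquality using (_≡_; _≢_)

record IsPartition (λ′ : List ℕ) : Set where
  field
    positive   : All (λ x → 0 < x) λ′
    decreasing : Linked _≥_ λ′

size : List ℕ → ℕ
size = sum

IsRectangle : List ℕ → Set
IsRectangle = Linked _≡_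

bAux : ℕ → List ℕ → ℕ
bAux i []       = 0
bAux i (x ∷ xs) = i * x + bAux (suc i) xs

b : List ℕ → ℕ
b = bAux 0

-- A filling is a list of rows (English notation: row 0 is the top row).
Filling : Set
Filling = List (List ℕ)

record IsSYT (λ′ : List ℕ) (T : Filling) : Set where
  field
    shape    : map length T ≡ λ′
    entries  : concat T ↭ applyUpTo suc (size λ′)
    rowsInc  : All (Linked _<_) T
    colsInc  : Linked (λ r r′ → All (uncurry _<_) (zip r r′)) T

rowOf : Filling → ℕ → ℕ
rowOf []       k = 0
rowOf (r ∷ rs) k = if any (λ x → x ≡ᵇ k) r then 0 else suc (rowOf rs k)

isDescentᵇ : Filling → ℕ → Bool
isDescentᵇ T i = rowOf T i <ᵇ rowOf T (suc i)

maj : Filling → ℕ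
maj T = sum (map (λ i → if isDescentᵇ T i then i else 0)
                 (applyUpTo suc (length (concat T) ∸ 1)))

CoeffZero : List ℕ → ℕ → Set
CoeffZero λ′ k = ∀ T → IsSYT λ′ T → maj T ≢ k

CoeffOne : List ℕ → ℕ → Set
CoeffOne λ′ k = Data.Product.Σ Filling λ T →
  (IsSYT λ′ T × maj T ≡ k) × (∀ T′ → IsSYT λ′ T′ → maj T′ ≡ k → T′ ≡ T)

module Submission where

-- The proof runs by induction on |λ| through the largest entry n of a tableau.
-- Removing n from the end of its row r leaves an SYT of shape λ - e_r and
-- changes maj by n - 1 exactly when n - 1 lies in a row above r.  From this:
--   * maj T ≥ b λ + excess λ r for every T, where r is the row of n and
--     excess λ r = Σ_{i<r} (λ_i - λ_r)  (so in particular maj T ≥ b λ);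
--   * stacking horizontal strips gives a tableau with maj = b λ, and, when
--     λ is not a rectangle, a variant of the last strip gives maj = b λ + 1;
--   * for a rectangle (c^(L+1)) we peel off the maximal run of largest
--     consecutive entries in the last row: either the whole row is such a run
--     (and we recurse on the smaller rectangle) or the lower bound already
--     forces maj T ≥ b + 2, with equality only for one explicit hook case.

open import Defs
open import Data.Bool using (Bool; true; false; if_then_else_; T)
open import Data.Bool.ListAction using (any)
open import Data.Empty using (⊥; ⊥-elim)
open import Data.List using (List; []; _∷_; _++_; _∷ʳ_; [_]; length; head; map; concat; zip; applyUpTo; take; drop; replicate)
open import Data.List.Membership.Propositional using (_∈_; _∉_)
open import Data.List.Membership.Propositional.Properties using (∈-++⁺ˡ; ∈-++⁺ʳ; ∈-++⁻)
open import Data.List.Properties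
  using (applyUpTo-∷ʳ; length-replicate; length-++; map-++; ++-assoc; length-map; ++-identityʳ; take++drop≡id; ∷-injective)
open import Data.List.Relation.Binary.Permutation.Propositional using (_↭_; ↭-refl; ↭-sym; ↭-trans; ↭-reflexive; prep)
open import Data.List.Relation.Binary.Permutation.Propositional.Properties
  using (shift; shifts; ++⁺ˡ; ++⁺ʳ; ++-comm; ∷↭∷ʳ; ∈-resp-↭; ↭-length; drop-∷; ↭-singleton-inv)
open import Data.List.Relation.Unary.All as All using (All; []; _∷_)
open import Data.List.Relation.Unary.All.Properties using (++⁺)
open import Data.List.Relation.Unary.Any using (here; there)
open import Data.List.Relation.Unary.Linked as Linked using (Linked; []; [-]; _∷_)
open import Data.Maybe using (just)
open import Data.Nat
  using (ℕ; zero; suc; pred; _+_; _*_; _∸_; _≤_; _<_; _≥_; z≤n; s≤s; z<s; _≡ᵇ_; _<ᵇ_; _<?_; _≤?_; >-nonZero)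
open import Data.Nat.ListAction using (sum)
open import Data.Nat.ListAction.Properties using (sum-++)
open import Data.Nat.Properties
open import Data.Nat.Solver using (module +-*-Solver)
open +-*-Solver using (solve; con; _:+_; _:=_)
open import Data.Product using (Σ; _×_; _,_; proj₁; proj₂; uncurry)
open import Data.Sum using (_⊎_; inj₁; inj₂)
open import Function.Bundles using (_⇔_; mk⇔)
open import Relation.Binary.PropositionalEquality
  using (_≡_; _≢_; refl; sym; trans; cong; cong₂; subst; subst₂; module ≡-Reasoning)
open import Data.List.Membership.DecPropositional _≟_ using (_∈?_)
open import Relation.Nullary using (¬_; Dec; yes; no)

range : ℕ → ℕ → List ℕ
range s zero    = []
range s (suc k) = s ∷ range (suc s) k

applyUpTo-suc≡range : ∀ n → applyUpTo suc n ≡ range 1 n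
applyUpTo-suc≡range n = shifted n 1 suc (λ _ → refl)
  where
  shifted : ∀ n s (f : ℕ → ℕ) → (∀ i → f i ≡ s + i) → applyUpTo f n ≡ range s n
  shifted zero    s f eq = refl
  shifted (suc n) s f eq =
    cong₂ _∷_ (trans (eq 0) (+-identityʳ s))
      (shifted n (suc s) (λ i → f (suc i)) (λ i → trans (eq (suc i)) (+-suc s i)))

range-snoc : ∀ s k → range s (suc k) ≡ range s k ∷ʳ (s + k)
range-snoc s zero    = cong [_] (sym (+-identityʳ s))
range-snoc s (suc k) = cong (s ∷_) (trans (range-snoc (suc s) k) (cong (range (suc s) k ∷ʳ_) (sym (+-suc s k))))

range-++ : ∀ s m k → range s m ++ range (s + m) k ≡ range s (m + k)
range-++ s zero    k = cong (λ z → range z k) (+-identityʳ s)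
range-++ s (suc m) k = cong (s ∷_) (trans (cong (λ z → range (suc s) m ++ range z k) (+-suc s m)) (range-++ (suc s) m k))

length-range : ∀ s k → length (range s k) ≡ k
length-range s zero    = refl
length-range s (suc k) = cong suc (length-range (suc s) k)

∈-range⁻ : ∀ {x} s k → x ∈ range s k → s ≤ x × x < s + k
∈-range⁻ s (suc k) (here refl) = ≤-refl , m<m+n s z<s
∈-range⁻ {x} s (suc k) (there p) with ∈-range⁻ (suc s) k p
... | s<x , x<s+k = <⇒≤ s<x , subst (x <_) (sym (+-suc s k)) x<s+k

∈-range⁺ : ∀ {x} s k → s ≤ x → x < s + k → x ∈ range s k
∈-range⁺ {x} s zero s≤x x<s+0 = ⊥-elim (<⇒≱ (subst (x <_) (+-identityʳ s) x<s+0) s≤x)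
∈-range⁺ {x} s (suc k) s≤x x<s+k with m≤n⇒m<n∨m≡n s≤x
... | inj₂ refl = here refl
... | inj₁ s<x  = there (∈-range⁺ (suc s) k s<x (subst (x <_) (+-suc s k) x<s+k))

∉-range-below : ∀ {x} s k → x < s → x ∉ range s k
∉-range-below s k x<s p = <⇒≱ x<s (proj₁ (∈-range⁻ s k p))

range-increasing : ∀ s k → Linked _<_ (range s k)
range-increasing s zero          = []
range-increasing s (suc zero)    = [-]
range-increasing s (suc (suc k)) = ≤-refl ∷ range-increasing (suc s) (suc k)

applyUpTo-suc-split : ∀ N x → applyUpTo suc (x + N) ≡ range 1 N ++ range (suc N) x
applyUpTo-suc-split N x =
  trans (applyUpTo-suc≡range (x + N)) (trans (cong (range 1) (+-comm x N)) (sym (range-++ 1 N x)))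

-- maj only depends on the function ρ = rowOf T; writing it as majBy ρ n lets
-- us compare the maj of two fillings whose row functions agree on 1 … n.

descentTerm : (ℕ → ℕ) → ℕ → ℕ
descentTerm ρ i = if ρ i <ᵇ ρ (suc i) then i else 0

majBy : (ℕ → ℕ) → ℕ → ℕ
majBy ρ n = sum (map (descentTerm ρ) (range 1 (n ∸ 1)))

maj≡majBy : ∀ T → maj T ≡ majBy (rowOf T) (length (concat T))
maj≡majBy T = cong (λ z → sum (map (descentTerm (rowOf T)) z)) (applyUpTo-suc≡range (length (concat T) ∸ 1))

if-same : ∀ (c : Bool) (x : ℕ) → (if c then x else x) ≡ x
if-same true  x = refl
if-same false x = refl

if-< : ∀ {a c} (x y : ℕ) → a < c → (if a <ᵇ c then x else y) ≡ x
if-< {a} {c} x y a<c with a <ᵇ c | <⇒<ᵇ a<c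
... | true | _ = refl

if-≮ : ∀ {a c} (x y : ℕ) → ¬ (a < c) → (if a <ᵇ c then x else y) ≡ y
if-≮ {a} {c} x y a≮c with a <ᵇ c in eq
... | false = refl
... | true  = ⊥-elim (a≮c (<ᵇ⇒< a c (subst T (sym eq) _)))

majBy-suc : ∀ ρ n → majBy ρ (suc n) ≡ majBy ρ n + descentTerm ρ n
majBy-suc ρ zero    = sym (if-same (ρ 0 <ᵇ ρ 1) 0)
majBy-suc ρ (suc n) = begin
  sum (map (descentTerm ρ) (range 1 (suc n)))
    ≡⟨ cong (λ z → sum (map (descentTerm ρ) z)) (range-snoc 1 n) ⟩
  sum (map (descentTerm ρ) (range 1 n ++ [ suc n ]))
    ≡⟨ cong sum (map-++ (descentTerm ρ) (range 1 n) [ suc n ]) ⟩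
  sum (map (descentTerm ρ) (range 1 n) ++ [ descentTerm ρ (suc n) ])
    ≡⟨ sum-++ (map (descentTerm ρ) (range 1 n)) [ descentTerm ρ (suc n) ] ⟩
  majBy ρ (suc n) + (descentTerm ρ (suc n) + 0)
    ≡⟨ cong (majBy ρ (suc n) +_) (+-identityʳ _) ⟩
  majBy ρ (suc n) + descentTerm ρ (suc n) ∎
  where open ≡-Reasoning

majBy-cong : ∀ ρ ρ′ n → (∀ i → 1 ≤ i → i ≤ n → ρ i ≡ ρ′ i) → majBy ρ n ≡ majBy ρ′ n
majBy-cong ρ ρ′ zero          agree = refl
majBy-cong ρ ρ′ (suc zero)    agree = refl
majBy-cong ρ ρ′ (suc (suc n)) agree =
  trans (majBy-suc ρ (suc n))
   (trans (cong₂ _+_ (majBy-cong ρ ρ′ (suc n) (λ i 1≤i i≤n → agree i 1≤i (m≤n⇒m≤1+n i≤n)))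
                     (cong₂ (λ u v → if u <ᵇ v then suc n else 0)
                            (agree (suc n) (s≤s z≤n) (n≤1+n _)) (agree (suc (suc n)) (s≤s z≤n) ≤-refl)))
     (sym (majBy-suc ρ′ (suc n))))

majBy-flat-row : ∀ ρ n → (∀ i → 1 ≤ i → i ≤ n → ρ i ≡ 0) → majBy ρ n ≡ 0
majBy-flat-row ρ n top = trans (majBy-cong ρ (λ _ → 0) n top) (sum-zeros (range 1 (n ∸ 1)))
  where
  sum-zeros : ∀ (xs : List ℕ) → sum (map (λ _ → 0) xs) ≡ 0
  sum-zeros []       = refl
  sum-zeros (x ∷ xs) = sum-zeros xs

majBy-no-descents : ∀ ρ m x → (∀ j → j < x → ¬ (ρ (suc m + j) < ρ (suc (suc m + j)))) →
                    majBy ρ (suc m + x) ≡ majBy ρ (suc m)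
majBy-no-descents ρ m zero    none = cong (majBy ρ) (+-identityʳ (suc m))
majBy-no-descents ρ m (suc x) none =
  trans (cong (majBy ρ) (+-suc (suc m) x))
   (trans (majBy-suc ρ (suc m + x))
    (trans (cong₂ _+_ (majBy-no-descents ρ m x (λ j j<x → none j (m<n⇒m<1+n j<x)))
                      (if-≮ _ 0 (none x ≤-refl)))
      (+-identityʳ _)))

any-≡ᵇ-∈ : ∀ {x} xs → x ∈ xs → any (λ y → y ≡ᵇ x) xs ≡ true
any-≡ᵇ-∈ {x} (y ∷ xs) (here refl) with x ≡ᵇ x | ≡⇒≡ᵇ x x refl
... | true | _ = refl
any-≡ᵇ-∈ {x} (y ∷ xs) (there p) with y ≡ᵇ x
... | true  = refl
... | false = any-≡ᵇ-∈ xs p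

any-≡ᵇ-∉ : ∀ {x} xs → x ∉ xs → any (λ y → y ≡ᵇ x) xs ≡ false
any-≡ᵇ-∉ []       x∉ = refl
any-≡ᵇ-∉ {x} (y ∷ xs) x∉ with y ≡ᵇ x in eq
... | true  = ⊥-elim (x∉ (here (sym (≡ᵇ⇒≡ y x (subst T (sym eq) _)))))
... | false = any-≡ᵇ-∉ xs (λ p → x∉ (there p))

rowOf-here : ∀ {x} row rows → x ∈ row → rowOf (row ∷ rows) x ≡ 0
rowOf-here {x} row rows p rewrite any-≡ᵇ-∈ row p = refl

rowOf-there : ∀ {x} row rows → x ∉ row → rowOf (row ∷ rows) x ≡ suc (rowOf rows x)
rowOf-there {x} row rows p rewrite any-≡ᵇ-∉ row p = refl

rowOf-< : ∀ {x} T → x ∈ concat T → rowOf T x < length T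
rowOf-< {x} (row ∷ rows) p with x ∈? row
... | yes q rewrite rowOf-here row rows q = z<s
... | no x∉row with ∈-++⁻ row p
...   | inj₁ q = ⊥-elim (x∉row q)
...   | inj₂ q rewrite rowOf-there row rows x∉row = s≤s (rowOf-< rows q)

partition-tail : ∀ {x xs} → IsPartition (x ∷ xs) → IsPartition xs
partition-tail p = record { positive = All.tail (IsPartition.positive p) ; decreasing = Linked.tail (IsPartition.decreasing p) }

syt-entry-bounds : ∀ {λ′ T} → IsSYT λ′ T → ∀ {x} → x ∈ concat T → 1 ≤ x × x ≤ size λ′
syt-entry-bounds {λ′} s {x} p with ∈-range⁻ 1 (size λ′) (subst (x ∈_) (applyUpTo-suc≡range (size λ′)) (∈-resp-↭ (IsSYT.entries s) p))
... | 1≤x , x<1+n = 1≤x , ≤-pred x<1+n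

syt-entry-∈ : ∀ {λ′ T} → IsSYT λ′ T → ∀ {x} → 1 ≤ x → x ≤ size λ′ → x ∈ concat T
syt-entry-∈ {λ′} s {x} 1≤x x≤n =
  ∈-resp-↭ (↭-sym (IsSYT.entries s)) (subst (x ∈_) (sym (applyUpTo-suc≡range (size λ′))) (∈-range⁺ 1 (size λ′) 1≤x (s≤s x≤n)))

syt-#entries : ∀ {λ′ T} → IsSYT λ′ T → length (concat T) ≡ size λ′
syt-#entries {λ′} s =
  trans (↭-length (IsSYT.entries s)) (trans (cong length (applyUpTo-suc≡range (size λ′))) (length-range 1 (size λ′)))

syt-#rows : ∀ {λ′ T} → IsSYT λ′ T → length T ≡ length λ′
syt-#rows {λ′} {T} s = trans (sym (length-map length T)) (cong length (IsSYT.shape s))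

syt-rowOf-< : ∀ {λ′ T} → IsSYT λ′ T → ∀ x → 1 ≤ x → x ≤ size λ′ → rowOf T x < length λ′
syt-rowOf-< {λ′} {T} s x 1≤x x≤n = subst (rowOf T x <_) (syt-#rows s) (rowOf-< T (syt-entry-∈ s 1≤x x≤n))

syt-entries-≤ : ∀ {λ′ T} → IsSYT λ′ T → All (All (_≤ size λ′)) T
syt-entries-≤ {λ′} {T} s = rows T (λ p → proj₂ (syt-entry-bounds s p))
  where
  rows : ∀ T → (∀ {x} → x ∈ concat T → x ≤ size λ′) → All (All (_≤ size λ′)) T
  rows []           bound = []
  rows (row ∷ rest) bound = All.tabulate (λ p → bound (∈-++⁺ˡ p)) ∷ rows rest (λ p → bound (∈-++⁺ʳ row p))

syt-entries-< : ∀ {λ′ T} → IsSYT λ′ T → All (All (_< suc (size λ′))) T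
syt-entries-< s = All.map (All.map s≤s) (syt-entries-≤ s)

all-rows-< : ∀ {b R x} → All (All (_< b)) R → x ∈ concat R → x < b
all-rows-< {R = r ∷ rs} (h ∷ hs) p with ∈-++⁻ r p
... | inj₁ p₁ = All.lookup h p₁
... | inj₂ p₂ = all-rows-< hs p₂

rows-nonempty : ∀ {λ′ T} → IsPartition λ′ → IsSYT λ′ T → All (λ row → 0 < length row) T
rows-nonempty {λ′} {T} p s = lengths T (subst (All (0 <_)) (sym (IsSYT.shape s)) (IsPartition.positive p))
  where
  lengths : ∀ T → All (0 <_) (map length T) → All (λ row → 0 < length row) T
  lengths []       []       = []
  lengths (r ∷ rs) (q ∷ qs) = q ∷ lengths rs qs

rows-decreasing : ∀ {λ′ T} → IsPartition λ′ → IsSYT λ′ T → Linked _≥_ (map length T)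
rows-decreasing {λ′} {T} p s = subst (Linked _≥_) (sym (IsSYT.shape s)) (IsPartition.decreasing p)

Below : List ℕ → List ℕ → Set
Below up down = All (uncurry _<_) (zip up down)

below-[] : ∀ up → Below up []
below-[] []      = []
below-[] (x ∷ a) = []

zip-++ˡ : ∀ (a a′ c : List ℕ) → length c ≤ length a → zip (a ++ a′) c ≡ zip a c
zip-++ˡ []      a′ [] _         = zip-[] a′
  where
  zip-[] : ∀ (xs : List ℕ) → zip xs ([] {A = ℕ}) ≡ []
  zip-[] []       = refl
  zip-[] (x ∷ xs) = refl
zip-++ˡ (x ∷ a) a′ []      _         = refl
zip-++ˡ (x ∷ a) a′ (y ∷ c) (s≤s le) = cong ((x , y) ∷_) (zip-++ˡ a a′ c le)

below-++ʳ : ∀ (a c d : List ℕ) → Below a c → All (λ x → All (x <_) d) a → Below a (c ++ d)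
below-++ʳ []      c       d       _          _  = []
below-++ʳ (x ∷ a) []      []      _          _  = []
below-++ʳ (x ∷ a) []      (y ∷ d) _          ((p ∷ _) ∷ h) =
  p ∷ below-++ʳ a [] d (below-[] a) (All.map All.tail h)
below-++ʳ (x ∷ a) (y ∷ c) d       (p ∷ cols) (_ ∷ h) = p ∷ below-++ʳ a c d cols h

below-++⁻ˡ : ∀ (a a′ c : List ℕ) → Below (a ++ a′) c → Below a c
below-++⁻ˡ []      a′ c       _          = []
below-++⁻ˡ (x ∷ a) a′ []      _          = []
below-++⁻ˡ (x ∷ a) a′ (y ∷ c) (p ∷ cols) = p ∷ below-++⁻ˡ a a′ c cols

below-++⁻ʳ : ∀ (a c d : List ℕ) → Below a (c ++ d) → Below a c
below-++⁻ʳ []      c       d _          = []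
below-++⁻ʳ (x ∷ a) []      d _          = []
below-++⁻ʳ (x ∷ a) (y ∷ c) d (p ∷ cols) = p ∷ below-++⁻ʳ a c d cols

below-shorter : ∀ (a c : List ℕ) n → Below (a ∷ʳ n) c → All (_≤ n) c → length c ≤ length a
below-shorter a       []      n _          _            = z≤n
below-shorter []      (y ∷ c) n (p ∷ _)    (q ∷ _)      = ⊥-elim (<-irrefl refl (<-≤-trans p q))
below-shorter (x ∷ a) (y ∷ c) n (p ∷ cols) (_ ∷ bounds) = s≤s (below-shorter a c n cols bounds)

all-below-range : ∀ (up : List ℕ) b s k → All (_< b) up → b ≤ s → All (λ x → All (x <_) (range s k)) up
all-below-range up b s k up<b b≤s =
  All.map (λ x<b → All.tabulate (λ p → <-≤-trans x<b (≤-trans b≤s (proj₁ (∈-range⁻ s k p))))) up<b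

increasing-++range : ∀ (xs : List ℕ) s k → Linked _<_ xs → All (_< s) xs → Linked _<_ (xs ++ range s k)
increasing-++range []           s k       _          _            = range-increasing s k
increasing-++range (x ∷ [])     s zero    _          _            = [-]
increasing-++range (x ∷ [])     s (suc k) _          (x<s ∷ _)    = x<s ∷ range-increasing s (suc k)
increasing-++range (x ∷ y ∷ xs) s k       (x<y ∷ l)  (_ ∷ bounds) = x<y ∷ increasing-++range (y ∷ xs) s k l bounds

linked-++⁻ˡ : ∀ {R : ℕ → ℕ → Set} (xs ys : List ℕ) → Linked R (xs ++ ys) → Linked R xs
linked-++⁻ˡ []           ys _       = []
linked-++⁻ˡ (x ∷ [])     ys _       = [-]
linked-++⁻ˡ (x ∷ y ∷ xs) ys (r ∷ l) = r ∷ linked-++⁻ˡ (y ∷ xs) ys l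

-- Growing a tableau: a new largest entry at the end of row r

addAt : ℕ → ℕ → Filling → Filling
addAt zero    e []           = [ e ] ∷ []
addAt zero    e (row ∷ rows) = (row ∷ʳ e) ∷ rows
addAt (suc r) e []           = [ e ] ∷ []
addAt (suc r) e (row ∷ rows) = row ∷ addAt r e rows

incAt : ℕ → List ℕ → List ℕ
incAt zero    []       = 1 ∷ []
incAt zero    (x ∷ xs) = suc x ∷ xs
incAt (suc r) []       = 1 ∷ []
incAt (suc r) (x ∷ xs) = x ∷ incAt r xs

length-snoc : ∀ (row : List ℕ) e → length (row ∷ʳ e) ≡ suc (length row)
length-snoc row e = trans (length-++ row) (+-comm (length row) 1)

shape-addAt : ∀ r e T → map length (addAt r e T) ≡ incAt r (map length T)
shape-addAt zero    e []           = refl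
shape-addAt zero    e (row ∷ rows) = cong (_∷ map length rows) (length-snoc row e)
shape-addAt (suc r) e []           = refl
shape-addAt (suc r) e (row ∷ rows) = cong (length row ∷_) (shape-addAt r e rows)

size-incAt : ∀ r μ → size (incAt r μ) ≡ suc (size μ)
size-incAt zero    []       = refl
size-incAt zero    (x ∷ xs) = refl
size-incAt (suc r) []       = refl
size-incAt (suc r) (x ∷ xs) = trans (cong (x +_) (size-incAt r xs)) (+-suc x (size xs))

length-incAt : ∀ r μ → r ≤ length μ → r < length (incAt r μ)
length-incAt zero    []       _        = s≤s z≤n
length-incAt zero    (x ∷ xs) _        = s≤s z≤n
length-incAt (suc r) (x ∷ xs) (s≤s le) = s≤s (length-incAt r xs le)

length-incAt-≥ : ∀ r μ → length μ ≤ length (incAt r μ)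
length-incAt-≥ zero    []       = z≤n
length-incAt-≥ zero    (x ∷ xs) = ≤-refl
length-incAt-≥ (suc r) []       = z≤n
length-incAt-≥ (suc r) (x ∷ xs) = s≤s (length-incAt-≥ r xs)

concat-addAt : ∀ r e T → concat (addAt r e T) ↭ e ∷ concat T
concat-addAt zero    e []           = ↭-refl
concat-addAt zero    e (row ∷ rows) =
  ↭-trans (↭-reflexive (++-assoc row [ e ] (concat rows))) (shift e row (concat rows))
concat-addAt (suc r) e []           = ↭-refl
concat-addAt (suc r) e (row ∷ rows) =
  ↭-trans (++⁺ˡ row (concat-addAt r e rows)) (shift e row (concat rows))

rowOf-addAt-old : ∀ r e T x → x ≢ e → x ∈ concat T → rowOf (addAt r e T) x ≡ rowOf T x
rowOf-addAt-old zero e (row ∷ rows) x x≢e p with x ∈? row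
... | yes q     = trans (rowOf-here (row ∷ʳ e) rows (∈-++⁺ˡ q)) (sym (rowOf-here row rows q))
... | no x∉row  = trans (rowOf-there (row ∷ʳ e) rows x∉row∷e) (sym (rowOf-there row rows x∉row))
  where
  x∉row∷e : x ∉ row ∷ʳ e
  x∉row∷e q with ∈-++⁻ row q
  ... | inj₁ q₁        = x∉row q₁
  ... | inj₂ (here eq) = x≢e eq
rowOf-addAt-old (suc r) e (row ∷ rows) x x≢e p with x ∈? row
... | yes q    = trans (rowOf-here row (addAt r e rows) q) (sym (rowOf-here row rows q))
... | no x∉row with ∈-++⁻ row p
...   | inj₁ q = ⊥-elim (x∉row q)
...   | inj₂ q = trans (rowOf-there row (addAt r e rows) x∉row)
                  (trans (cong suc (rowOf-addAt-old r e rows x x≢e q)) (sym (rowOf-there row rows x∉row)))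

rowOf-addAt-new : ∀ r e T → e ∉ concat T → r ≤ length T → rowOf (addAt r e T) e ≡ r
rowOf-addAt-new zero    e []           _   _        = rowOf-here [ e ] [] (here refl)
rowOf-addAt-new zero    e (row ∷ rows) _   _        = rowOf-here (row ∷ʳ e) rows (∈-++⁺ʳ row (here refl))
rowOf-addAt-new (suc r) e (row ∷ rows) e∉ (s≤s le) =
  trans (rowOf-there row (addAt r e rows) (λ q → e∉ (∈-++⁺ˡ q)))
        (cong suc (rowOf-addAt-new r e rows (λ q → e∉ (∈-++⁺ʳ row q)) le))

addAt-increasing : ∀ r e T → All (Linked _<_) T → All (All (_< e)) T → All (Linked _<_) (addAt r e T)
addAt-increasing zero    e []           _        _        = [-] ∷ []
addAt-increasing zero    e (row ∷ rows) (l ∷ ls) (b ∷ bs) = increasing-++range row e 1 l b ∷ ls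
addAt-increasing (suc r) e []           _        _        = [-] ∷ []
addAt-increasing (suc r) e (row ∷ rows) (l ∷ ls) (b ∷ bs) = l ∷ addAt-increasing r e rows ls bs

addAt-columns : ∀ r e T → Linked Below T → Linked _≥_ (map length T) → All (All (_< e)) T →
                Linked Below (addAt r e T)
addAt-columns zero e []                  _          _        _ = [-]
addAt-columns zero e (row ∷ [])          _          _        _ = [-]
addAt-columns zero e (row ∷ row₁ ∷ rows) (c ∷ cs)   (l ∷ ls) _ =
  subst (All (uncurry _<_)) (sym (zip-++ˡ row [ e ] row₁ l)) c ∷ cs
addAt-columns (suc r) e []   _ _ _ = [-]
addAt-columns (suc zero) e (row ∷ []) _ _ (b ∷ _) =
  below-++ʳ row [] [ e ] (below-[] row) (All.map (_∷ []) b) ∷ [-]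
addAt-columns (suc (suc r)) e (row ∷ []) _ _ (b ∷ _) =
  below-++ʳ row [] [ e ] (below-[] row) (All.map (_∷ []) b) ∷ [-]
addAt-columns (suc zero) e (row ∷ row₁ ∷ rows) (c ∷ cs) (l ∷ ls) (b ∷ bs) =
  below-++ʳ row row₁ [ e ] c (All.map (_∷ []) b) ∷ addAt-columns zero e (row₁ ∷ rows) cs ls bs
addAt-columns (suc (suc r)) e (row ∷ row₁ ∷ rows) (c ∷ cs) (l ∷ ls) (b ∷ bs) =
  c ∷ addAt-columns (suc r) e (row₁ ∷ rows) cs ls bs

addAt-SYT : ∀ {μ T N} r → IsPartition μ → IsSYT μ T → size μ ≡ N → IsSYT (incAt r μ) (addAt r (suc N) T)
addAt-SYT {μ} {T} r pμ s refl = record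
  { shape   = trans (shape-addAt r (suc (size μ)) T) (cong (incAt r) (IsSYT.shape s))
  ; entries = ↭-trans (concat-addAt r (suc (size μ)) T)
               (↭-trans (prep _ (IsSYT.entries s))
                 (↭-trans (∷↭∷ʳ (suc (size μ)) (applyUpTo suc (size μ)))
                   (↭-reflexive (trans (applyUpTo-∷ʳ suc (size μ)) (cong (applyUpTo suc) (sym (size-incAt r μ)))))))
  ; rowsInc = addAt-increasing r _ T (IsSYT.rowsInc s) (syt-entries-< s)
  ; colsInc = addAt-columns r _ T (IsSYT.colsInc s) (rows-decreasing pμ s) (syt-entries-< s)
  }

new-entry-∉ : ∀ {μ T} → IsSYT μ T → suc (size μ) ∉ concat T
new-entry-∉ s p = <-irrefl refl (s≤s (proj₂ (syt-entry-bounds s p)))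

addAt-rowOf-new : ∀ {μ T N} r → IsSYT μ T → size μ ≡ N → r ≤ length T → rowOf (addAt r (suc N) T) (suc N) ≡ r
addAt-rowOf-new r s refl r≤ = rowOf-addAt-new r _ _ (new-entry-∉ s) r≤

addAt-maj : ∀ {μ T} r N → IsSYT μ T → size μ ≡ N → r ≤ length T →
            maj (addAt r (suc N) T) ≡ maj T + (if rowOf T N <ᵇ r then N else 0)
addAt-maj {μ} {T} r N s refl r≤ = begin
  maj T⁺                               ≡⟨ maj≡majBy T⁺ ⟩
  majBy ρ⁺ (length (concat T⁺))        ≡⟨ cong (majBy ρ⁺) #T⁺ ⟩
  majBy ρ⁺ (suc N)                     ≡⟨ majBy-suc ρ⁺ N ⟩
  majBy ρ⁺ N + descentTerm ρ⁺ N        ≡⟨ cong₂ _+_ (majBy-cong ρ⁺ ρ N (λ i 1≤i i≤N → old i (syt-entry-∈ s 1≤i i≤N)))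
                                                    (last-descent N refl) ⟩
  majBy ρ N + (if ρ N <ᵇ r then N else 0)
    ≡⟨ cong (_+ (if ρ N <ᵇ r then N else 0)) (trans (cong (majBy ρ) (sym (syt-#entries s))) (sym (maj≡majBy T))) ⟩
  maj T + (if ρ N <ᵇ r then N else 0)  ∎
  where
  open ≡-Reasoning
  T⁺ : Filling
  T⁺ = addAt r (suc N) T
  ρ⁺ ρ : ℕ → ℕ
  ρ⁺ = rowOf T⁺
  ρ  = rowOf T
  #T⁺ : length (concat T⁺) ≡ suc N
  #T⁺ = trans (↭-length (concat-addAt r (suc N) T)) (cong suc (syt-#entries s))
  old : ∀ x → x ∈ concat T → ρ⁺ x ≡ ρ x
  old x p = rowOf-addAt-old r _ T x (λ eq → new-entry-∉ s (subst (_∈ concat T) eq p)) p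
  last-descent : ∀ M → M ≡ N → descentTerm ρ⁺ M ≡ (if ρ M <ᵇ r then M else 0)
  last-descent zero    _  = trans (if-same (ρ⁺ 0 <ᵇ ρ⁺ 1) 0) (sym (if-same (ρ 0 <ᵇ r) 0))
  last-descent (suc k) eq = cong₂ (λ u v → if u <ᵇ v then suc k else 0)
    (old (suc k) (syt-entry-∈ s (s≤s z≤n) (≤-reflexive eq)))
    (subst (λ z → rowOf T⁺ z ≡ r) (cong suc (sym eq)) (addAt-rowOf-new r s refl r≤))

-- Removing the largest entry
--
-- In an SYT with entries 1 … N+1 the entry N+1 ends its row r and is at the
-- bottom of its column, so T = addAt r (N+1) T′ for an SYT T′ of a partition
-- μ with λ = incAt r μ.

ends-with-max : ∀ n row → Linked _<_ row → All (_≤ n) row → n ∈ row → Σ (List ℕ) λ init → row ≡ init ∷ʳ n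
ends-with-max n (x ∷ [])     _         _            (here refl) = [] , refl
ends-with-max n (x ∷ y ∷ xs) (x<y ∷ _) (_ ∷ y≤n ∷ _) (here refl) = ⊥-elim (<⇒≱ x<y y≤n)
ends-with-max n (x ∷ y ∷ xs) (_ ∷ l)   (_ ∷ bounds)  (there p) with ends-with-max n (y ∷ xs) l bounds p
... | init , eq = x ∷ init , cong (x ∷_) eq

largest-at-corner : ∀ n T → All (Linked _<_) T → Linked Below T → All (All (_≤ n)) T →
                    All (λ row → 0 < length row) T → n ∈ concat T →
                    Σ ℕ λ r → Σ Filling λ T′ → T ≡ addAt r n T′ × r ≤ length T′ × All (λ row → 0 < length row) T′
largest-at-corner n (row ∷ rows) (l ∷ ls) cs (b ∷ bs) (p ∷ ps) n∈ with n ∈? row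
... | yes q with ends-with-max n row l b q
largest-at-corner n (row ∷ []) _ _ _ _ _
    | yes q | [] , refl = 0 , [] , refl , z≤n , []
largest-at-corner n (row ∷ (y ∷ row₁) ∷ rows) _ ((n<y ∷ _) ∷ _) (_ ∷ ((y≤n ∷ _) ∷ _)) _ _
    | yes q | [] , refl = ⊥-elim (<⇒≱ n<y y≤n)
largest-at-corner n (row ∷ [] ∷ rows) _ _ _ (_ ∷ () ∷ _) _
    | yes q | [] , refl
largest-at-corner n (row ∷ rows) _ _ _ (_ ∷ ps) _
    | yes q | (i ∷ is) , refl = 0 , (i ∷ is) ∷ rows , refl , z≤n , s≤s z≤n ∷ ps
largest-at-corner n (row ∷ rows) (l ∷ ls) cs (b ∷ bs) (p ∷ ps) n∈ | no n∉row with ∈-++⁻ row n∈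
... | inj₁ m = ⊥-elim (n∉row m)
... | inj₂ m with largest-at-corner n rows ls (Linked.tail cs) bs ps m
...   | r , T′ , eq , r≤ , pos = suc r , row ∷ T′ , cong (row ∷_) eq , s≤s r≤ , p ∷ pos

addAt-increasing⁻ : ∀ r e T′ → All (Linked _<_) (addAt r e T′) → All (Linked _<_) T′
addAt-increasing⁻ zero    e []           _        = []
addAt-increasing⁻ zero    e (row ∷ rows) (l ∷ ls) = linked-++⁻ˡ row [ e ] l ∷ ls
addAt-increasing⁻ (suc r) e []           _        = []
addAt-increasing⁻ (suc r) e (row ∷ rows) (l ∷ ls) = l ∷ addAt-increasing⁻ r e rows ls

addAt-columns⁻ : ∀ r e T′ → Linked Below (addAt r e T′) → Linked Below T′
addAt-columns⁻ zero    e []                  _        = []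
addAt-columns⁻ zero    e (row ∷ [])          _        = [-]
addAt-columns⁻ zero    e (row ∷ row₁ ∷ rows) (c ∷ cs) = below-++⁻ˡ row [ e ] row₁ c ∷ cs
addAt-columns⁻ (suc r) e []                  _        = []
addAt-columns⁻ (suc r) e (row ∷ [])          _        = [-]
addAt-columns⁻ (suc zero) e (row ∷ row₁ ∷ rows) (c ∷ cs) =
  below-++⁻ʳ row row₁ [ e ] c ∷ addAt-columns⁻ zero e (row₁ ∷ rows) cs
addAt-columns⁻ (suc (suc r)) e (row ∷ row₁ ∷ rows) (c ∷ cs) = c ∷ addAt-columns⁻ (suc r) e (row₁ ∷ rows) cs

addAt-shape⁻ : ∀ r e T′ → Linked _≥_ (map length (addAt r e T′)) → Linked Below (addAt r e T′) →
               All (All (_≤ e)) (addAt r e T′) → Linked _≥_ (map length T′)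
addAt-shape⁻ zero    e []                  _        _        _            = []
addAt-shape⁻ zero    e (row ∷ [])          _        _        _            = [-]
addAt-shape⁻ zero    e (row ∷ row₁ ∷ rows) (_ ∷ ds) (c ∷ _)  (_ ∷ b ∷ _)  = below-shorter row row₁ e c b ∷ ds
addAt-shape⁻ (suc r) e []                  _        _        _            = []
addAt-shape⁻ (suc r) e (row ∷ [])          _        _        _            = [-]
addAt-shape⁻ (suc zero) e (row ∷ row₁ ∷ rows) (d ∷ ds) (_ ∷ cs) (_ ∷ bs) =
  ≤-trans (n≤1+n _) (≤-trans (≤-reflexive (sym (length-snoc row₁ e))) d) ∷ addAt-shape⁻ zero e (row₁ ∷ rows) ds cs bs
addAt-shape⁻ (suc (suc r)) e (row ∷ row₁ ∷ rows) (d ∷ ds) (_ ∷ cs) (_ ∷ bs) =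
  d ∷ addAt-shape⁻ (suc r) e (row₁ ∷ rows) ds cs bs

record Removal (λ′ : List ℕ) (T : Filling) (N : ℕ) : Set where
  field
    r       : ℕ
    T′      : Filling
    eqT     : T ≡ addAt r (suc N) T′
    r≤      : r ≤ length T′
    part    : IsPartition (map length T′)
    syt     : IsSYT (map length T′) T′
    eqλ     : λ′ ≡ incAt r (map length T′)
    size-μ  : size (map length T′) ≡ N
  μ : List ℕ
  μ = map length T′
  r≤μ : r ≤ length μ
  r≤μ = subst (r ≤_) (sym (length-map length T′)) r≤
  rowOf-largest : rowOf T (suc N) ≡ r
  rowOf-largest = trans (cong (λ z → rowOf z (suc N)) eqT) (addAt-rowOf-new r syt size-μ r≤)
  maj-step : maj T ≡ maj T′ + (if rowOf T′ N <ᵇ r then N else 0)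
  maj-step = trans (cong maj eqT) (addAt-maj r N syt size-μ r≤)

removeLargest : ∀ {λ′ T} N → IsPartition λ′ → IsSYT λ′ T → size λ′ ≡ suc N → Removal λ′ T N
removeLargest {λ′} {T} N pλ s sz = record
  { r = r ; T′ = T′ ; eqT = eqT ; r≤ = r≤
  ; part = record { positive = positive pos ; decreasing = decreasing }
  ; syt = record { shape = refl ; entries = entries
                 ; rowsInc = addAt-increasing⁻ r n T′ (subst (All (Linked _<_)) eqT (IsSYT.rowsInc s))
                 ; colsInc = addAt-columns⁻ r n T′ (subst (Linked Below) eqT (IsSYT.colsInc s)) }
  ; eqλ = eqλ
  ; size-μ = size-μ
  }
  where
  n : ℕ
  n = suc N
  bounds : All (All (_≤ n)) T
  bounds = subst (λ z → All (All (_≤ z)) T) sz (syt-entries-≤ s)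
  corner : Σ ℕ λ r → Σ Filling λ T′ → T ≡ addAt r n T′ × r ≤ length T′ × All (λ row → 0 < length row) T′
  corner = largest-at-corner n T (IsSYT.rowsInc s) (IsSYT.colsInc s) bounds (rows-nonempty pλ s)
             (syt-entry-∈ s (s≤s z≤n) (≤-reflexive (sym sz)))
  r : ℕ
  r   = proj₁ corner
  T′ : Filling
  T′  = proj₁ (proj₂ corner)
  eqT : T ≡ addAt r n T′
  eqT = proj₁ (proj₂ (proj₂ corner))
  r≤  : r ≤ length T′
  r≤  = proj₁ (proj₂ (proj₂ (proj₂ corner)))
  pos : All (λ row → 0 < length row) T′
  pos = proj₂ (proj₂ (proj₂ (proj₂ corner)))
  positive : ∀ {R} → All (λ row → 0 < length row) R → All (0 <_) (map length R)
  positive []       = []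
  positive (p ∷ ps) = p ∷ positive ps
  eqλ : λ′ ≡ incAt r (map length T′)
  eqλ = trans (sym (IsSYT.shape s)) (trans (cong (map length) eqT) (shape-addAt r n T′))
  size-μ : size (map length T′) ≡ N
  size-μ = suc-injective (trans (sym (size-incAt r (map length T′))) (trans (cong size (sym eqλ)) sz))
  decreasing : Linked _≥_ (map length T′)
  decreasing = addAt-shape⁻ r n T′ (subst (λ z → Linked _≥_ (map length z)) eqT (rows-decreasing pλ s))
                 (subst (Linked Below) eqT (IsSYT.colsInc s)) (subst (All (All (_≤ n))) eqT bounds)
  entries : concat T′ ↭ applyUpTo suc (size (map length T′))
  entries = subst (λ z → concat T′ ↭ applyUpTo suc z) (sym size-μ)
    (drop-∷ (↭-trans (↭-sym (concat-addAt r n T′))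
             (↭-trans (↭-reflexive (cong concat (sym eqT)))
              (↭-trans (IsSYT.entries s)
               (↭-trans (↭-reflexive (cong (applyUpTo suc) sz))
                (↭-sym (↭-trans (∷↭∷ʳ n (applyUpTo suc N)) (↭-reflexive (applyUpTo-∷ʳ suc N)))))))))

bAux-suc : ∀ i xs → bAux (suc i) xs ≡ bAux i xs + size xs
bAux-suc i []       = refl
bAux-suc i (x ∷ xs) =
  trans (cong ((x + i * x) +_) (bAux-suc (suc i) xs)) (rearrange x (i * x) (bAux (suc i) xs) (size xs))
  where
  rearrange : ∀ a c d e → (a + c) + (d + e) ≡ (c + d) + (a + e)
  rearrange = solve 4 (λ a c d e → (a :+ c) :+ (d :+ e) := (c :+ d) :+ (a :+ e)) refl

-- b (x ∷ λ) = b λ + |λ|: every row of λ moves one step down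
b-cons : ∀ x xs → b (x ∷ xs) ≡ b xs + size xs
b-cons x xs = bAux-suc 0 xs

bAux-incAt : ∀ i r μ → r ≤ length μ → bAux i (incAt r μ) ≡ bAux i μ + (i + r)
bAux-incAt i zero [] _ = trans (cong (_+ 0) (*-identityʳ i)) (trans (+-identityʳ i) (sym (+-identityʳ i)))
bAux-incAt i zero (x ∷ xs) _ =
  trans (cong (_+ bAux (suc i) xs) (*-suc i x))
   (trans (+-assoc i (i * x) _)
    (trans (+-comm i _) (cong (i * x + bAux (suc i) xs +_) (sym (+-identityʳ i)))))
bAux-incAt i (suc r) (x ∷ xs) (s≤s le) =
  trans (cong (i * x +_) (bAux-incAt (suc i) r xs le))
   (trans (sym (+-assoc (i * x) (bAux (suc i) xs) _)) (cong (i * x + bAux (suc i) xs +_) (sym (+-suc i r))))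

b-incAt : ∀ r μ → r ≤ length μ → b (incAt r μ) ≡ b μ + r
b-incAt r μ le = bAux-incAt 0 r μ le

-- A lower bound for maj
--
-- excess λ r = Σ_{i<r} (λ_i - λ_r) counts the boxes in rows above r to the
-- right of column λ_r.  We show b λ + excess λ r ≤ maj T when the largest
-- entry of T lies in row r.

at : List ℕ → ℕ → ℕ
at []       k       = 0
at (x ∷ xs) zero    = x
at (x ∷ xs) (suc k) = at xs k

excess : List ℕ → ℕ → ℕ
excess λ′ r = sum (map (_∸ at λ′ r) (take r λ′))

second≤first : ∀ {x xs} → Linked _≥_ (x ∷ xs) → at xs 0 ≤ x
second≤first {x} {[]}     _       = z≤n
second≤first {x} {y ∷ xs} (l ∷ _) = l

at-antitone : ∀ {xs} → Linked _≥_ xs → ∀ {i j} → i ≤ j → at xs j ≤ at xs i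
at-antitone {[]}     _ _ = z≤n
at-antitone {x ∷ xs} d {zero}  {zero}  _        = ≤-refl
at-antitone {x ∷ xs} d {zero}  {suc j} _        = ≤-trans (at-antitone (Linked.tail d) {0} {j} z≤n) (second≤first d)
at-antitone {x ∷ xs} d {suc i} {suc j} (s≤s le) = at-antitone (Linked.tail d) le

take-≥-at : ∀ {xs} → Linked _≥_ xs → ∀ r → All (at xs r ≤_) (take r xs)
take-≥-at {[]}     _ zero    = []
take-≥-at {[]}     _ (suc r) = []
take-≥-at {x ∷ xs} d zero    = []
take-≥-at {x ∷ xs} d (suc r) = at-antitone d {0} {suc r} z≤n ∷ take-≥-at (Linked.tail d) r

length-take≤ : ∀ r (xs : List ℕ) → r ≤ length xs → length (take r xs) ≡ r
length-take≤ zero    xs       _        = refl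
length-take≤ (suc r) (x ∷ xs) (s≤s le) = cong suc (length-take≤ r xs le)

sum-∸-const : ∀ v xs → All (v ≤_) xs → sum (map (_∸ v) xs) + length xs * v ≡ sum xs
sum-∸-const v []       _        = refl
sum-∸-const v (x ∷ xs) (p ∷ ps) =
  trans (rearrange (x ∸ v) (sum (map (_∸ v) xs)) v (length xs * v))
    (cong₂ _+_ (m∸n+n≡m p) (sum-∸-const v xs ps))
  where
  rearrange : ∀ a c d e → (a + c) + (d + e) ≡ (a + d) + (c + e)
  rearrange = solve 4 (λ a c d e → (a :+ c) :+ (d :+ e) := (a :+ d) :+ (c :+ e)) refl

sum-∸-suc : ∀ v xs → All (suc v ≤_) xs → sum (map (_∸ v) xs) ≡ sum (map (_∸ suc v) xs) + length xs
sum-∸-suc v []       _        = refl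
sum-∸-suc v (x ∷ xs) (p ∷ ps) =
  trans (cong₂ _+_ (∸-suc x p) (sum-∸-suc v xs ps))
        (solve 3 (λ a c d → (con 1 :+ a) :+ (c :+ d) := (a :+ c) :+ (con 1 :+ d)) refl (x ∸ suc v) _ (length xs))
  where
  ∸-suc : ∀ x → suc v ≤ x → x ∸ v ≡ suc (x ∸ suc v)
  ∸-suc (suc x) (s≤s q) = +-∸-assoc 1 q

sum-∸-antitone : ∀ {v w} → v ≤ w → ∀ xs → sum (map (_∸ w) xs) ≤ sum (map (_∸ v) xs)
sum-∸-antitone v≤w []       = z≤n
sum-∸-antitone v≤w (x ∷ xs) = +-mono-≤ (∸-monoʳ-≤ x v≤w) (sum-∸-antitone v≤w xs)

sum-take-mono : ∀ (f : ℕ → ℕ) {r s} → r ≤ s → ∀ xs → sum (map f (take r xs)) ≤ sum (map f (take s xs))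
sum-take-mono f {zero}  _        xs       = z≤n
sum-take-mono f {suc r} {suc s} (s≤s le) []       = z≤n
sum-take-mono f {suc r} {suc s} (s≤s le) (x ∷ xs) = +-monoʳ-≤ (f x) (sum-take-mono f le xs)

take-incAt : ∀ r μ → r ≤ length μ → take r (incAt r μ) ≡ take r μ
take-incAt zero    []       _        = refl
take-incAt zero    (x ∷ xs) _        = refl
take-incAt (suc r) (x ∷ xs) (s≤s le) = cong (x ∷_) (take-incAt r xs le)

at-incAt : ∀ r μ → r ≤ length μ → at (incAt r μ) r ≡ suc (at μ r)
at-incAt zero    []       _        = refl
at-incAt zero    (x ∷ xs) _        = refl
at-incAt (suc r) (x ∷ xs) (s≤s le) = at-incAt r xs le

-- There are at least r + excess λ r + 1 boxes: the rectangle of the first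
-- r rows cut at column λ_r, the excess, and the box (r, 0).
excess-room : ∀ λ′ r → IsPartition λ′ → r < length λ′ → suc (r + excess λ′ r) ≤ size λ′
excess-room λ′ r p r<len = begin
  suc (r + excess λ′ r)                               ≡⟨ cong suc (+-comm r _) ⟩
  suc (excess λ′ r + r)                               ≤⟨ s≤s (+-monoʳ-≤ (excess λ′ r) (≤-trans (≤-reflexive (sym (*-identityʳ r))) (*-monoʳ-≤ r v≥1))) ⟩
  suc (excess λ′ r + r * v)                           ≡⟨ cong (λ z → suc (excess λ′ r + z * v)) (sym (length-take≤ r λ′ (<⇒≤ r<len))) ⟩
  suc (excess λ′ r + length (take r λ′) * v)          ≡⟨ cong suc (sum-∸-const v (take r λ′) (take-≥-at (IsPartition.decreasing p) r)) ⟩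
  suc (sum (take r λ′))                               ≡⟨ +-comm 1 (sum (take r λ′)) ⟩
  sum (take r λ′) + 1                                 ≤⟨ +-monoʳ-≤ (sum (take r λ′)) (≤-trans v≥1 (at≤sum-drop λ′ r)) ⟩
  sum (take r λ′) + sum (drop r λ′)                   ≡⟨ sym (sum-++ (take r λ′) (drop r λ′)) ⟩
  sum (take r λ′ ++ drop r λ′)                        ≡⟨ cong sum (take++drop≡id r λ′) ⟩
  size λ′                                             ∎
  where
  open ≤-Reasoning
  v : ℕ
  v = at λ′ r
  positive-at : ∀ {xs} → All (0 <_) xs → ∀ r → r < length xs → 0 < at xs r
  positive-at (q ∷ _)  zero    _         = q
  positive-at (_ ∷ qs) (suc r) (s≤s lt) = positive-at qs r lt
  v≥1 : 1 ≤ v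
  v≥1 = positive-at (IsPartition.positive p) r r<len
  at≤sum-drop : ∀ xs r → at xs r ≤ sum (drop r xs)
  at≤sum-drop []       zero    = z≤n
  at≤sum-drop []       (suc r) = z≤n
  at≤sum-drop (x ∷ xs) zero    = m≤m+n x _
  at≤sum-drop (x ∷ xs) (suc r) = at≤sum-drop xs r

excess-step : ∀ r μ s → r ≤ length μ → Linked _≥_ μ → Linked _≥_ (incAt r μ) → r ≤ s →
              r + excess (incAt r μ) r ≤ excess μ s
excess-step r μ s r≤len dμ dλ r≤s = begin
  r + excess (incAt r μ) r                                   ≡⟨ +-comm r _ ⟩
  excess (incAt r μ) r + r                                   ≡⟨ cong₂ (λ u v → sum (map (_∸ u) v) + r) (at-incAt r μ r≤len) (take-incAt r μ r≤len) ⟩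
  sum (map (_∸ suc (at μ r)) (take r μ)) + r                 ≡⟨ cong (sum (map (_∸ suc (at μ r)) (take r μ)) +_) (sym (length-take≤ r μ r≤len)) ⟩
  sum (map (_∸ suc (at μ r)) (take r μ)) + length (take r μ) ≡⟨ sym (sum-∸-suc (at μ r) (take r μ) above) ⟩
  sum (map (_∸ at μ r) (take r μ))                           ≤⟨ sum-∸-antitone (at-antitone dμ r≤s) (take r μ) ⟩
  sum (map (_∸ at μ s) (take r μ))                           ≤⟨ sum-take-mono (_∸ at μ s) r≤s μ ⟩
  excess μ s                                                 ∎
  where
  open ≤-Reasoning
  above : All (suc (at μ r) ≤_) (take r μ)
  above = subst₂ (λ u v → All (u ≤_) v) (at-incAt r μ r≤len) (take-incAt r μ r≤len) (take-≥-at dλ r)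

size≡0 : ∀ {λ′} → All (0 <_) λ′ → size λ′ ≡ 0 → λ′ ≡ []
size≡0 []          _  = refl
size≡0 (s≤s _ ∷ _) ()

excess-[] : ∀ r → excess [] r ≡ 0
excess-[] zero    = refl
excess-[] (suc r) = refl

maj-lower-bound : ∀ N {λ′ T} → IsPartition λ′ → IsSYT λ′ T → size λ′ ≡ N →
                  b λ′ + excess λ′ (rowOf T N) ≤ maj T
maj-lower-bound zero    {λ′} {T} pλ s sz rewrite size≡0 (IsPartition.positive pλ) sz | excess-[] (rowOf T 0) = z≤n
maj-lower-bound (suc N) {λ′} {T} pλ s sz =
  subst₂ _≤_ (cong₂ (λ u v → b u + excess u v) (sym eqλ) (sym (Removal.rowOf-largest R)))
             (sym (Removal.maj-step R)) (step (rowOf T′ N <? r))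
  where
  R : Removal λ′ T N
  R = removeLargest N pλ s sz
  open Removal R using (r; T′; μ; r≤μ; eqλ)
  IH : b μ + excess μ (rowOf T′ N) ≤ maj T′
  IH = maj-lower-bound N (Removal.part R) (Removal.syt R) (Removal.size-μ R)
  pλ′ : IsPartition (incAt r μ)
  pλ′ = subst IsPartition eqλ pλ
  b-split : b (incAt r μ) + excess (incAt r μ) r ≡ b μ + (r + excess (incAt r μ) r)
  b-split = trans (cong (_+ excess (incAt r μ) r) (b-incAt r μ r≤μ)) (+-assoc (b μ) r _)
  step : Dec (rowOf T′ N < r) → b (incAt r μ) + excess (incAt r μ) r ≤ maj T′ + (if rowOf T′ N <ᵇ r then N else 0)
  step (yes above) = begin
    b (incAt r μ) + excess (incAt r μ) r   ≡⟨ b-split ⟩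
    b μ + (r + excess (incAt r μ) r)       ≤⟨ +-mono-≤ (≤-trans (m≤m+n (b μ) _) IH)
                                                 (≤-pred (≤-trans (excess-room (incAt r μ) r pλ′ (length-incAt r μ r≤μ))
                                                   (≤-reflexive (trans (size-incAt r μ) (cong suc (Removal.size-μ R)))))) ⟩
    maj T′ + N                             ≡⟨ cong (maj T′ +_) (sym (if-< N 0 above)) ⟩
    maj T′ + (if rowOf T′ N <ᵇ r then N else 0) ∎
    where open ≤-Reasoning
  step (no not-above) = begin
    b (incAt r μ) + excess (incAt r μ) r   ≡⟨ b-split ⟩
    b μ + (r + excess (incAt r μ) r)       ≤⟨ +-monoʳ-≤ (b μ) (excess-step r μ _ r≤μ (IsPartition.decreasing (Removal.part R))
                                                 (IsPartition.decreasing pλ′) (≮⇒≥ not-above)) ⟩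
    b μ + excess μ (rowOf T′ N)            ≤⟨ IH ⟩
    maj T′                                 ≡⟨ sym (+-identityʳ _) ⟩
    maj T′ + 0                             ≡⟨ cong (maj T′ +_) (sym (if-≮ N 0 not-above)) ⟩
    maj T′ + (if rowOf T′ N <ᵇ r then N else 0) ∎
    where open ≤-Reasoning

b≤maj : ∀ {λ′ T} → IsPartition λ′ → IsSYT λ′ T → b λ′ ≤ maj T
b≤maj {λ′} pλ s = ≤-trans (m≤m+n (b λ′) _) (maj-lower-bound (size λ′) pλ s refl)

-- Adding a horizontal strip on top
--
-- For a filling R of shape λ and p ≥ λ₀, addStrip s p R has shape p ∷ λ:
-- each row of R is lengthened to the length of the row above it (p for
-- the top row) and a new bottom row of length λ_last is created.  The new
-- boxes form a horizontal strip, filled with s, s+1, … from the bottom row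
-- upwards.

addStrip : ℕ → ℕ → Filling → Filling
addStrip s p []           = range s p ∷ []
addStrip s p (row ∷ rows) = (row ++ range (s + length row) (p ∸ length row)) ∷ addStrip s (length row) rows

headLength : Filling → ℕ
headLength []          = 0
headLength (row ∷ _)   = length row

headLength-≤ : ∀ (row : List ℕ) {rows} → Linked _≥_ (map length (row ∷ rows)) → headLength rows ≤ length row
headLength-≤ row {[]}       _       = z≤n
headLength-≤ row {r₁ ∷ rows} (d ∷ _) = d

length-padded : ∀ s p (row : List ℕ) → length row ≤ p → length (row ++ range (s + length row) (p ∸ length row)) ≡ p
length-padded s p row le = trans (length-++ row) (trans (cong (length row +_) (length-range _ _)) (m+[n∸m]≡n le))

addStrip-shape : ∀ s p R → Linked _≥_ (map length R) → headLength R ≤ p → map length (addStrip s p R) ≡ p ∷ map length R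
addStrip-shape s p []           _ _  = cong [_] (length-range s p)
addStrip-shape s p (row ∷ rows) d le =
  cong₂ _∷_ (length-padded s p row le) (addStrip-shape s (length row) rows (Linked.tail d) (headLength-≤ row d))

addStrip-entries : ∀ s p R → Linked _≥_ (map length R) → headLength R ≤ p → concat (addStrip s p R) ↭ concat R ++ range s p
addStrip-entries s p []           _ _  = ↭-reflexive (++-identityʳ (range s p))
addStrip-entries s p (row ∷ rows) d le =
  ↭-trans (↭-reflexive (++-assoc row new _))
   (↭-trans (++⁺ˡ row (++⁺ˡ new (addStrip-entries s L rows (Linked.tail d) (headLength-≤ row d))))
    (↭-trans (++⁺ˡ row (++-comm new (concat rows ++ range s L)))
     (↭-trans (↭-reflexive (cong (row ++_) (++-assoc (concat rows) (range s L) new)))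
      (↭-reflexive (trans (cong (λ z → row ++ (concat rows ++ z)) (trans (range-++ s L (p ∸ L)) (cong (range s) (m+[n∸m]≡n le))))
                          (sym (++-assoc row (concat rows) (range s p))))))))
  where
  L : ℕ
  L = length row
  new : List ℕ
  new = range (s + L) (p ∸ L)

addStrip-increasing : ∀ s p R → All (Linked _<_) R → All (All (_< s)) R → All (Linked _<_) (addStrip s p R)
addStrip-increasing s p []           _        _        = range-increasing s p ∷ []
addStrip-increasing s p (row ∷ rows) (l ∷ ls) (b ∷ bs) =
  increasing-++range row (s + length row) _ l (All.map (λ q → <-≤-trans q (m≤m+n s _)) b)
    ∷ addStrip-increasing s (length row) rows ls bs

addStrip-top : ∀ s (up : List ℕ) R → All (_< s) up → (∀ {row₁ rows′} → R ≡ row₁ ∷ rows′ → Below up row₁) →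
               Linked _≥_ (map length R) → ∀ p → headLength R ≤ p →
               Σ (List ℕ) λ h → Σ Filling λ t → addStrip s p R ≡ h ∷ t × Below up h × length h ≡ p
addStrip-top s up []            up<s _     _ p _  =
  range s p , [] , refl , below-++ʳ up [] (range s p) (below-[] up) (all-below-range up s s p up<s ≤-refl) , length-range s p
addStrip-top s up (row₁ ∷ rows) up<s below _ p le =
  _ , _ , refl , below-++ʳ up row₁ _ (below refl) (all-below-range up s _ _ up<s (m≤m+n s _)) , length-padded s p row₁ le

addStrip-columns : ∀ s p R → Linked Below R → Linked _≥_ (map length R) → All (All (_< s)) R → Linked Below (addStrip s p R)
addStrip-columns s p []           _ _ _        = [-]
addStrip-columns s p (row ∷ rows) c d (b ∷ bs)
  with addStrip-top s row rows b (λ { refl → Linked.head c }) (Linked.tail d) (length row) (headLength-≤ row d)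
     | addStrip-columns s (length row) rows (Linked.tail c) (Linked.tail d) bs
... | h , t , eq , below , len-h | rest =
  subst (λ z → Linked Below ((row ++ range (s + length row) (p ∸ length row)) ∷ z)) (sym eq)
    (subst (All (uncurry _<_)) (sym (zip-++ˡ row _ h (≤-reflexive len-h))) below ∷ subst (Linked Below) eq rest)

addStrip-rowOf-old : ∀ s p R x → x ∈ concat R → All (All (_< s)) R → rowOf (addStrip s p R) x ≡ rowOf R x
addStrip-rowOf-old s p (row ∷ rows) x x∈ (b ∷ bs) with x ∈? row
... | yes q = trans (rowOf-here _ (addStrip s (length row) rows) (∈-++⁺ˡ q)) (sym (rowOf-here row rows q))
... | no x∉row with ∈-++⁻ row x∈
...   | inj₁ q = ⊥-elim (x∉row q)
...   | inj₂ q = trans (rowOf-there _ (addStrip s (length row) rows) x∉padded)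
                  (trans (cong suc (addStrip-rowOf-old s (length row) rows x q bs)) (sym (rowOf-there row rows x∉row)))
  where
  x∉padded : x ∉ row ++ range (s + length row) (p ∸ length row)
  x∉padded x∈padded with ∈-++⁻ row x∈padded
  ... | inj₁ q₁ = x∉row q₁
  ... | inj₂ q₂ = ∉-range-below (s + length row) _ (<-≤-trans (all-rows-< bs q) (m≤m+n s _)) q₂

∈-top-strip : ∀ s p (row : List ℕ) e → length row ≤ p → s + length row ≤ e → e < s + p →
              e ∈ row ++ range (s + length row) (p ∸ length row)
∈-top-strip s p row e le ge lt =
  ∈-++⁺ʳ row (∈-range⁺ _ _ ge (subst (e <_) (sym (trans (+-assoc s (length row) _) (cong (s +_) (m+[n∸m]≡n le)))) lt))

∉-top-strip : ∀ s p (row : List ℕ) e → All (_< s) row → s ≤ e → e < s + length row →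
              e ∉ row ++ range (s + length row) (p ∸ length row)
∉-top-strip s p row e row<s s≤e lt q with ∈-++⁻ row q
... | inj₁ q₁ = <⇒≱ (All.lookup row<s q₁) s≤e
... | inj₂ q₂ = ∉-range-below _ _ lt q₂

-- larger new entries lie weakly higher: the strip has no internal descents
addStrip-rowOf-antitone : ∀ s p R e e′ → Linked _≥_ (map length R) → headLength R ≤ p → All (All (_< s)) R →
                          s ≤ e → e ≤ e′ → e′ < s + p → rowOf (addStrip s p R) e′ ≤ rowOf (addStrip s p R) e
addStrip-rowOf-antitone s p [] e e′ d le b s≤e e≤e′ e′<s+p =
  ≤-reflexive (trans (rowOf-here (range s p) [] (∈-range⁺ s p (≤-trans s≤e e≤e′) e′<s+p))
                     (sym (rowOf-here (range s p) [] (∈-range⁺ s p s≤e (≤-<-trans e≤e′ e′<s+p)))))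
addStrip-rowOf-antitone s p (row ∷ rows) e e′ d le (b ∷ bs) s≤e e≤e′ e′<s+p with s + length row ≤? e′
... | yes in-top = ≤-trans (≤-reflexive (rowOf-here _ (addStrip s (length row) rows) (∈-top-strip s p row e′ le in-top e′<s+p))) z≤n
... | no below-top =
  ≤-trans (≤-reflexive (rowOf-there _ (addStrip s (length row) rows) (∉-top-strip s p row e′ b (≤-trans s≤e e≤e′) (≰⇒> below-top))))
   (≤-trans (s≤s (addStrip-rowOf-antitone s (length row) rows e e′ (Linked.tail d) (headLength-≤ row d) bs s≤e e≤e′ (≰⇒> below-top)))
     (≤-reflexive (sym (rowOf-there _ (addStrip s (length row) rows) (∉-top-strip s p row e b s≤e (≤-<-trans e≤e′ (≰⇒> below-top)))))))

addStrip-rowOf-first : ∀ s p R → 1 ≤ p → All (λ row → 0 < length row) R → All (All (_< s)) R →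
                       Linked _≥_ (map length R) → headLength R ≤ p → rowOf (addStrip s p R) s ≡ length R
addStrip-rowOf-first s p [] 1≤p _ _ _ _ = rowOf-here (range s p) [] (∈-range⁺ s p ≤-refl (m<m+n s 1≤p))
addStrip-rowOf-first s p (row ∷ rows) _ (q ∷ qs) (b ∷ bs) d le =
  trans (rowOf-there _ (addStrip s (length row) rows) (∉-top-strip s p row s b ≤-refl (m<m+n s q)))
        (cong suc (addStrip-rowOf-first s (length row) rows q qs bs (Linked.tail d) (headLength-≤ row d)))

headLength-≤-part : ∀ {x λ′ T} → IsPartition (x ∷ λ′) → IsSYT λ′ T → headLength T ≤ x
headLength-≤-part {T = []}         p s = z≤n
headLength-≤-part {x} {λ′} {row ∷ rows} p s with IsSYT.shape s | IsPartition.decreasing p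
... | refl | l ∷ _ = l

addStrip-SYT : ∀ {x λ′ T} → IsPartition (x ∷ λ′) → IsSYT λ′ T → IsSYT (x ∷ λ′) (addStrip (suc (size λ′)) x T)
addStrip-SYT {x} {λ′} {T} p s = record
  { shape   = trans (addStrip-shape _ x T d (headLength-≤-part p s)) (cong (x ∷_) (IsSYT.shape s))
  ; entries = ↭-trans (addStrip-entries _ x T d (headLength-≤-part p s))
               (↭-trans (++⁺ʳ _ (↭-trans (IsSYT.entries s) (↭-reflexive (applyUpTo-suc≡range (size λ′)))))
                 (↭-reflexive (sym (applyUpTo-suc-split (size λ′) x))))
  ; rowsInc = addStrip-increasing _ x T (IsSYT.rowsInc s) (syt-entries-< s)
  ; colsInc = addStrip-columns _ x T (IsSYT.colsInc s) d (syt-entries-< s)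
  }
  where
  d : Linked _≥_ (map length T)
  d = rows-decreasing (partition-tail p) s

partition-nonempty-size : ∀ {λ′} → IsPartition λ′ → λ′ ≢ [] → 1 ≤ size λ′
partition-nonempty-size {[]}     p ne = ⊥-elim (ne refl)
partition-nonempty-size {x ∷ xs} p ne = ≤-trans (All.head (IsPartition.positive p)) (m≤m+n x _)

-- The strip adds exactly one descent, at N = |λ|: N+1 opens the new bottom row.
addStrip-maj : ∀ {x λ′ T} → IsPartition (x ∷ λ′) → IsSYT λ′ T → λ′ ≢ [] →
               maj (addStrip (suc (size λ′)) x T) ≡ maj T + size λ′
addStrip-maj {zero} p s ne with All.head (IsPartition.positive p)
... | ()
addStrip-maj {suc x′} {λ′} {T} p s ne = begin
  maj T⁺                                 ≡⟨ maj≡majBy T⁺ ⟩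
  majBy ρ⁺ (length (concat T⁺))          ≡⟨ cong (majBy ρ⁺) (trans (syt-#entries (addStrip-SYT p s)) (trans (+-comm (suc x′) N) (+-suc N x′))) ⟩
  majBy ρ⁺ (suc N + x′)                  ≡⟨ majBy-no-descents ρ⁺ N x′ strip-flat ⟩
  majBy ρ⁺ (suc N)                       ≡⟨ majBy-suc ρ⁺ N ⟩
  majBy ρ⁺ N + descentTerm ρ⁺ N          ≡⟨ cong₂ _+_ (majBy-cong ρ⁺ ρ N old) (if-< N 0 descent) ⟩
  majBy ρ N + N                          ≡⟨ cong (_+ N) (trans (cong (majBy ρ) (sym (syt-#entries s))) (sym (maj≡majBy T))) ⟩
  maj T + N                              ∎
  where
  open ≡-Reasoning
  N : ℕ
  N  = size λ′
  T⁺ : Filling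
  T⁺ = addStrip (suc N) (suc x′) T
  ρ⁺ ρ : ℕ → ℕ
  ρ⁺ = rowOf T⁺
  ρ  = rowOf T
  pλ : IsPartition λ′
  pλ = partition-tail p
  d : Linked _≥_ (map length T)
  d  = rows-decreasing pλ s
  old : ∀ i → 1 ≤ i → i ≤ N → ρ⁺ i ≡ ρ i
  old i 1≤i i≤N = addStrip-rowOf-old _ _ T i (syt-entry-∈ s 1≤i i≤N) (syt-entries-< s)
  strip-flat : ∀ j → j < x′ → ¬ (ρ⁺ (suc N + j) < ρ⁺ (suc (suc N + j)))
  strip-flat j j<x′ = ≤⇒≯ (addStrip-rowOf-antitone (suc N) (suc x′) T _ _ d (headLength-≤-part p s) (syt-entries-< s)
                         (m≤m+n _ j) (n≤1+n _)
                         (s≤s (subst (suc (suc (N + j)) ≤_) (sym (+-suc N x′)) (s≤s (subst (_≤ N + x′) (+-suc N j) (+-monoʳ-≤ N j<x′))))))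
  N≥1 : 1 ≤ N
  N≥1 = partition-nonempty-size pλ ne
  descent : ρ⁺ N < ρ⁺ (suc N)
  descent = subst₂ _<_ (sym (old N N≥1 ≤-refl))
              (sym (trans (addStrip-rowOf-first (suc N) (suc x′) T (s≤s z≤n) (rows-nonempty pλ s) (syt-entries-< s) d
                                                (headLength-≤-part p s)) (syt-#rows s)))
              (syt-rowOf-< s N N≥1 ≤-refl)

minimalTableau : List ℕ → Filling
minimalTableau []       = []
minimalTableau (x ∷ λ′) = addStrip (suc (size λ′)) x (minimalTableau λ′)

minimalTableau-SYT : ∀ λ′ → IsPartition λ′ → IsSYT λ′ (minimalTableau λ′)
minimalTableau-SYT []       p = record { shape = refl ; entries = ↭-refl ; rowsInc = [] ; colsInc = [] }
minimalTableau-SYT (x ∷ λ′) p = addStrip-SYT p (minimalTableau-SYT λ′ (partition-tail p))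

minimalTableau-maj : ∀ λ′ → IsPartition λ′ → maj (minimalTableau λ′) ≡ b λ′
minimalTableau-maj []           p = refl
minimalTableau-maj (x ∷ [])     p = trans (maj≡majBy T₁) (majBy-flat-row _ _ one-row)
  where
  T₁ : Filling
  T₁ = minimalTableau (x ∷ [])
  one-row : ∀ i → 1 ≤ i → i ≤ length (concat T₁) → rowOf T₁ i ≡ 0
  one-row i 1≤i i≤len = rowOf-here (range 1 x) [] (∈-range⁺ 1 x 1≤i
    (s≤s (≤-trans i≤len (≤-reflexive (trans (syt-#entries (minimalTableau-SYT (x ∷ []) p)) (+-identityʳ x))))))
minimalTableau-maj (x ∷ y ∷ λ′) p =
  trans (addStrip-maj p (minimalTableau-SYT (y ∷ λ′) (partition-tail p)) (λ ()))
   (trans (cong (_+ size (y ∷ λ′)) (minimalTableau-maj (y ∷ λ′) (partition-tail p))) (sym (b-cons x (y ∷ λ′))))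

-- Non-rectangles: a tableau with maj = b λ + 1
--
-- If the top row of T (of shape λ) is shorter than x, put N+1 = |λ|+1 at the
-- end of the top row and then add the strip with N+2, …  Now N is no longer
-- a descent (N+1 stays in the top row) but N+1 is, so maj grows by N+1
-- instead of N.

addStrip⁺ : ℕ → ℕ → Filling → Filling
addStrip⁺ N x []           = []
addStrip⁺ N x (row ∷ rows) =
  ((row ∷ʳ suc N) ++ range (suc (suc N) + length row) (x ∸ suc (length row))) ∷ addStrip (suc (suc N)) (length row) rows

module AddStrip⁺ (x : ℕ) (row : List ℕ) (rows : Filling) (λ′ : List ℕ)
                 (p : IsPartition (x ∷ λ′)) (s : IsSYT λ′ (row ∷ rows)) (L<x : length row < x) where

  N s₂ L : ℕ
  N  = size λ′
  s₂ = suc (suc N)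
  L  = length row
  strip top : List ℕ
  strip = range (s₂ + L) (x ∸ suc L)
  top   = (row ∷ʳ suc N) ++ strip
  S T⁺ : Filling
  S  = addStrip s₂ L rows
  T⁺ = top ∷ S

  d-rows : Linked _≥_ (map length rows)
  d-rows = Linked.tail (rows-decreasing (partition-tail p) s)
  head≤ : headLength rows ≤ L
  head≤ = headLength-≤ row (rows-decreasing (partition-tail p) s)
  row<N+1 : All (_< suc N) row
  row<N+1 = All.head (syt-entries-< s)
  row<s₂ : All (_< s₂) row
  row<s₂ = All.map (λ q → ≤-trans q (n≤1+n _)) row<N+1
  rows<s₂ : All (All (_< s₂)) rows
  rows<s₂ = All.map (All.map (λ q → ≤-trans q (n≤1+n _))) (All.tail (syt-entries-< s))
  L≥1 : 1 ≤ L
  L≥1 = All.head (rows-nonempty (partition-tail p) s)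
  x≥2 : 2 ≤ x
  x≥2 = ≤-trans (s≤s L≥1) L<x

  shape : map length T⁺ ≡ x ∷ λ′
  shape = cong₂ _∷_ length-top (trans (addStrip-shape s₂ L rows d-rows head≤) (IsSYT.shape s))
    where
    length-top : length top ≡ x
    length-top = trans (length-++ (row ∷ʳ suc N))
                   (trans (cong₂ _+_ (length-snoc row (suc N)) (length-range _ _)) (m+[n∸m]≡n L<x))

  new-entries : suc N ∷ (range s₂ L ++ strip) ≡ range (suc N) x
  new-entries = trans (cong (suc N ∷_) (trans (range-++ s₂ L (x ∸ suc L)) (cong (range s₂) (cong pred (m+[n∸m]≡n L<x)))))
                      (sym (range-first (suc N) x (≤-trans (s≤s z≤n) L<x)))
    where
    range-first : ∀ s x → 1 ≤ x → range s x ≡ s ∷ range (suc s) (pred x)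
    range-first s (suc x) _ = refl

  entries : concat T⁺ ↭ applyUpTo suc (size (x ∷ λ′))
  entries =
    ↭-trans (++⁺ˡ top (addStrip-entries s₂ L rows d-rows head≤))
    (↭-trans (↭-reflexive (trans (++-assoc (row ∷ʳ suc N) strip _) (++-assoc row [ suc N ] _)))
    (↭-trans (++⁺ˡ row (++⁺ˡ [ suc N ] (++-comm strip (concat rows ++ range s₂ L))))
    (↭-trans (↭-reflexive (cong (λ z → row ++ (suc N ∷ z)) (++-assoc (concat rows) (range s₂ L) strip)))
    (↭-trans (++⁺ˡ row (shifts [ suc N ] (concat rows)))
    (↭-trans (↭-reflexive (sym (++-assoc row (concat rows) _)))
    (↭-trans (++⁺ʳ _ (↭-trans (IsSYT.entries s) (↭-reflexive (applyUpTo-suc≡range N))))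
      (↭-reflexive (trans (cong (range 1 N ++_) new-entries) (sym (applyUpTo-suc-split N x))))))))))

  rowsInc : All (Linked _<_) T⁺
  rowsInc = increasing-++range (row ∷ʳ suc N) (s₂ + L) _ (increasing-++range row (suc N) 1 (All.head (IsSYT.rowsInc s)) row<N+1)
              (++⁺ (All.map (λ q → ≤-trans q (≤-trans (n≤1+n _) (m≤m+n s₂ L))) row<N+1) ((s≤s (s≤s (m≤m+n N L))) ∷ []))
            ∷ addStrip-increasing s₂ L rows (All.tail (IsSYT.rowsInc s)) rows<s₂

  colsInc : Linked Below T⁺
  colsInc with addStrip-top s₂ row rows row<s₂ (λ { refl → Linked.head (IsSYT.colsInc s) }) d-rows L head≤
  ... | h , t , eq , below , len-h =
    subst (λ z → Linked Below (top ∷ z)) (sym eq)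
      (subst (All (uncurry _<_))
             (sym (trans (zip-++ˡ (row ∷ʳ suc N) strip h (≤-trans (≤-reflexive len-h) (≤-trans (n≤1+n L) (≤-reflexive (sym (length-snoc row (suc N)))))))
                         (zip-++ˡ row [ suc N ] h (≤-reflexive len-h)))) below
       ∷ subst (Linked Below) eq (addStrip-columns s₂ L rows (Linked.tail (IsSYT.colsInc s)) d-rows rows<s₂))

  syt : IsSYT (x ∷ λ′) T⁺
  syt = record { shape = shape ; entries = entries ; rowsInc = rowsInc ; colsInc = colsInc }

  ρ⁺ ρ : ℕ → ℕ
  ρ⁺ = rowOf T⁺
  ρ  = rowOf (row ∷ rows)

  ∉-top : ∀ e → suc N < e → e < s₂ + L → e ∉ top
  ∉-top e N+1<e e<end e∈ with ∈-++⁻ (row ∷ʳ suc N) e∈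
  ... | inj₂ q = ∉-range-below (s₂ + L) _ e<end q
  ... | inj₁ q with ∈-++⁻ row q
  ...   | inj₁ q′        = <-asym (All.lookup row<N+1 q′) N+1<e
  ...   | inj₂ (here eq) = <-irrefl (sym eq) N+1<e

  old : ∀ i → 1 ≤ i → i ≤ N → ρ⁺ i ≡ ρ i
  old i 1≤i i≤N with i ∈? row
  ... | yes q    = trans (rowOf-here top S (∈-++⁺ˡ (∈-++⁺ˡ q))) (sym (rowOf-here row rows q))
  ... | no i∉row with ∈-++⁻ row (syt-entry-∈ s 1≤i i≤N)
  ...   | inj₁ q = ⊥-elim (i∉row q)
  ...   | inj₂ q = trans (rowOf-there top S i∉top)
                     (trans (cong suc (addStrip-rowOf-old s₂ L rows i q rows<s₂)) (sym (rowOf-there row rows i∉row)))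
    where
    i∉top : i ∉ top
    i∉top i∈ with ∈-++⁻ (row ∷ʳ suc N) i∈
    ... | inj₂ q₂ = ∉-range-below (s₂ + L) _ (≤-trans (s≤s (≤-trans i≤N (n≤1+n N))) (m≤m+n s₂ L)) q₂
    ... | inj₁ q₁ with ∈-++⁻ row q₁
    ...   | inj₁ q₃        = i∉row q₃
    ...   | inj₂ (here eq) = <-irrefl eq (s≤s i≤N)

  ρ-N+1 : ρ⁺ (suc N) ≡ 0
  ρ-N+1 = rowOf-here top S (∈-++⁺ˡ (∈-++⁺ʳ row (here refl)))

  ρ-N+2 : ρ⁺ s₂ ≡ suc (rowOf S s₂)
  ρ-N+2 = rowOf-there top S (∉-top s₂ ≤-refl (m<m+n s₂ L≥1))

  end-of-top : s₂ + L + (x ∸ suc L) ≡ suc N + x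
  end-of-top = trans (cong (_+ (x ∸ suc L)) (sym (+-suc (suc N) L)))
                 (trans (+-assoc (suc N) (suc L) (x ∸ suc L)) (cong (suc N +_) (m+[n∸m]≡n L<x)))

  strip-flat : ∀ j → j < x ∸ 2 → ¬ (ρ⁺ (s₂ + j) < ρ⁺ (suc (s₂ + j)))
  strip-flat j j<x-2 with s₂ + L ≤? suc (s₂ + j)
  ... | yes in-top = λ desc → <-irrefl refl (<-≤-trans (≤-trans (s≤s z≤n) desc) (≤-reflexive in-top-row))
    where
    bound : suc (s₂ + j) < s₂ + L + (x ∸ suc L)
    bound = subst (suc (s₂ + j) <_) (sym end-of-top)
             (s≤s (subst (_≤ N + x) (trans (+-suc N (suc (suc j))) (cong suc (trans (+-suc N (suc j)) (cong suc (+-suc N j)))))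
                  (+-monoʳ-≤ N (subst (suc (suc (suc j)) ≤_) (m+[n∸m]≡n x≥2) (s≤s (s≤s j<x-2))))))
    in-top-row : ρ⁺ (suc (s₂ + j)) ≡ 0
    in-top-row = rowOf-here top S (∈-++⁺ʳ (row ∷ʳ suc N) (∈-range⁺ (s₂ + L) (x ∸ suc L) in-top bound))
  ... | no below-top = ≤⇒≯ (≤-trans (≤-reflexive (rowOf-there top S (∉-top _ (≤-trans (m≤m+n s₂ j) (n≤1+n _)) (≰⇒> below-top))))
                        (≤-trans (s≤s (addStrip-rowOf-antitone s₂ L rows (s₂ + j) (suc (s₂ + j)) d-rows head≤ rows<s₂
                                         (m≤m+n s₂ j) (n≤1+n _) (≰⇒> below-top)))
                          (≤-reflexive (sym (rowOf-there top S (∉-top _ (m≤m+n s₂ j) (<-trans (n<1+n _) (≰⇒> below-top))))))))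

  maj-T⁺ : maj T⁺ ≡ maj (row ∷ rows) + suc N
  maj-T⁺ = begin
    maj T⁺                                            ≡⟨ maj≡majBy T⁺ ⟩
    majBy ρ⁺ (length (concat T⁺))                     ≡⟨ cong (majBy ρ⁺) (trans (syt-#entries syt) (trans (+-comm x N) N+x)) ⟩
    majBy ρ⁺ (suc (suc N) + (x ∸ 2))                  ≡⟨ majBy-no-descents ρ⁺ (suc N) (x ∸ 2) strip-flat ⟩
    majBy ρ⁺ (suc (suc N))                            ≡⟨ majBy-suc ρ⁺ (suc N) ⟩
    majBy ρ⁺ (suc N) + descentTerm ρ⁺ (suc N)         ≡⟨ cong (_+ descentTerm ρ⁺ (suc N)) (majBy-suc ρ⁺ N) ⟩
    majBy ρ⁺ N + descentTerm ρ⁺ N + descentTerm ρ⁺ (suc N)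
      ≡⟨ cong₂ _+_ (cong₂ _+_ (majBy-cong ρ⁺ ρ N old) (cong (λ z → if ρ⁺ N <ᵇ z then N else 0) ρ-N+1))
                   (cong₂ (λ u v → if u <ᵇ v then suc N else 0) ρ-N+1 ρ-N+2) ⟩
    majBy ρ N + 0 + suc N                             ≡⟨ cong (_+ suc N) (trans (+-identityʳ _) (trans (cong (majBy ρ) (sym (syt-#entries s)))
                                                                                                    (sym (maj≡majBy (row ∷ rows))))) ⟩
    maj (row ∷ rows) + suc N                          ∎
    where
    open ≡-Reasoning
    N+x : N + x ≡ suc (suc N) + (x ∸ 2)
    N+x = trans (cong (N +_) (sym (m+[n∸m]≡n x≥2))) (trans (+-suc N (suc (x ∸ 2))) (cong suc (+-suc N (x ∸ 2))))

addStrip⁺-SYT-maj : ∀ {x λ′ T} → IsPartition (x ∷ λ′) → IsSYT λ′ T → λ′ ≢ [] → headLength T < x →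
                    IsSYT (x ∷ λ′) (addStrip⁺ (size λ′) x T) × maj (addStrip⁺ (size λ′) x T) ≡ maj T + suc (size λ′)
addStrip⁺-SYT-maj {T = []}         p s ne _   = ⊥-elim (ne (sym (IsSYT.shape s)))
addStrip⁺-SYT-maj {x} {λ′} {row ∷ rows} p s ne L<x = AddStrip⁺.syt x row rows λ′ p s L<x , AddStrip⁺.maj-T⁺ x row rows λ′ p s L<x

-- Some T ∈ SYT(λ) has maj T = b λ + 1 unless λ is a rectangle: use the first
-- strict descent λ_i > λ_{i+1}, minimal below it and addStrip⁺ at row i.
non-rectangle-b+1 : ∀ λ′ → IsPartition λ′ → ¬ IsRectangle λ′ → Σ Filling λ T → IsSYT λ′ T × maj T ≡ b λ′ + 1
non-rectangle-b+1 []           p not-rect = ⊥-elim (not-rect [])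
non-rectangle-b+1 (x ∷ [])     p not-rect = ⊥-elim (not-rect [-])
non-rectangle-b+1 (x ∷ y ∷ λ″) p not-rect = extend (x ≟ y) (non-rectangle-b+1 (y ∷ λ″) (partition-tail p))
  where
  open ≡-Reasoning
  λ′ : List ℕ
  λ′ = y ∷ λ″
  extend : Dec (x ≡ y) → (¬ IsRectangle λ′ → Σ Filling λ T → IsSYT λ′ T × maj T ≡ b λ′ + 1) →
           Σ Filling λ T → IsSYT (x ∷ λ′) T × maj T ≡ b (x ∷ λ′) + 1
  extend (yes x≡y) rec with rec (λ rect → not-rect (x≡y ∷ rect))
  ... | T′ , s′ , m′ = addStrip (suc (size λ′)) x T′ , addStrip-SYT p s′ , (begin
    maj (addStrip (suc (size λ′)) x T′) ≡⟨ addStrip-maj p s′ (λ ()) ⟩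
    maj T′ + size λ′                    ≡⟨ cong (_+ size λ′) m′ ⟩
    b λ′ + 1 + size λ′                  ≡⟨ +-assoc (b λ′) 1 _ ⟩
    b λ′ + (1 + size λ′)                ≡⟨ cong (b λ′ +_) (+-comm 1 _) ⟩
    b λ′ + (size λ′ + 1)                ≡⟨ sym (+-assoc (b λ′) _ 1) ⟩
    b λ′ + size λ′ + 1                  ≡⟨ cong (_+ 1) (sym (b-cons x λ′)) ⟩
    b (x ∷ λ′) + 1                      ∎)
  extend (no x≢y) _ = addStrip⁺ (size λ′) x T₀ , proj₁ bumped , (begin
    maj (addStrip⁺ (size λ′) x T₀) ≡⟨ proj₂ bumped ⟩
    maj T₀ + suc (size λ′)         ≡⟨ cong (_+ suc (size λ′)) (minimalTableau-maj λ′ (partition-tail p)) ⟩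
    b λ′ + suc (size λ′)           ≡⟨ +-suc (b λ′) (size λ′) ⟩
    suc (b λ′ + size λ′)           ≡⟨ +-comm 1 (b λ′ + size λ′) ⟩
    b λ′ + size λ′ + 1             ≡⟨ cong (_+ 1) (sym (b-cons x λ′)) ⟩
    b (x ∷ λ′) + 1                 ∎)
    where
    T₀ : Filling
    T₀ = minimalTableau λ′
    s₀ : IsSYT λ′ T₀
    s₀ = minimalTableau-SYT λ′ (partition-tail p)
    top-length : headLength T₀ ≡ y
    top-length with T₀ | IsSYT.shape s₀
    ... | row ∷ rows | eq = proj₁ (∷-injective eq)
    y<x : headLength T₀ < x
    y<x = subst (_< x) (sym top-length) (≤∧≢⇒< (Linked.head (IsPartition.decreasing p)) (λ e → x≢y (sym e)))
    bumped : IsSYT (x ∷ λ′) (addStrip⁺ (size λ′) x T₀) × maj (addStrip⁺ (size λ′) x T₀) ≡ maj T₀ + suc (size λ′)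
    bumped = addStrip⁺-SYT-maj p s₀ (λ ()) y<x

-- Runs: consecutive entries appended to one row
--
-- addRun r e k T appends e, e+1, …, e+k-1 to row r.  Only the first of them
-- can create a descent, so maj changes as for a single entry.

addRun : ℕ → ℕ → ℕ → Filling → Filling
addRun r e zero    T = T
addRun r e (suc k) T = addAt r (e + k) (addRun r e k T)

incRun : ℕ → ℕ → List ℕ → List ℕ
incRun r zero    μ = μ
incRun r (suc k) μ = incAt r (incRun r k μ)

addRun-1 : ∀ r e T → addRun r e 1 T ≡ addAt r e T
addRun-1 r e T = cong (λ z → addAt r z T) (+-identityʳ e)

size-incRun : ∀ r k μ → size (incRun r k μ) ≡ size μ + k
size-incRun r zero    μ = sym (+-identityʳ _)
size-incRun r (suc k) μ = trans (size-incAt r (incRun r k μ)) (trans (cong suc (size-incRun r k μ)) (sym (+-suc _ k)))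

length-incRun-≥ : ∀ r k μ → length μ ≤ length (incRun r k μ)
length-incRun-≥ r zero    μ = ≤-refl
length-incRun-≥ r (suc k) μ = ≤-trans (length-incRun-≥ r k μ) (length-incAt-≥ r (incRun r k μ))

addRun-SYT : ∀ r k {μ T N} → IsSYT μ T → size μ ≡ N →
             (∀ j → j < k → IsPartition (incRun r j μ)) → IsSYT (incRun r k μ) (addRun r (suc N) k T)
addRun-SYT r zero    s sz parts = s
addRun-SYT r (suc k) {μ} s sz parts =
  addAt-SYT r (parts k ≤-refl) (addRun-SYT r k s sz (λ j j<k → parts j (m<n⇒m<1+n j<k)))
    (trans (size-incRun r k μ) (cong (_+ k) sz))

addRun-maj : ∀ r k {μ T N} → IsSYT μ T → size μ ≡ N → r ≤ length μ →
             (∀ j → j ≤ k → IsPartition (incRun r j μ)) →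
             maj (addRun r (suc N) (suc k) T) ≡ maj T + (if rowOf T N <ᵇ r then N else 0)
             × rowOf (addRun r (suc N) (suc k) T) (suc N + k) ≡ r
addRun-maj r zero {μ} {T} {N} s sz r≤ parts =
  trans (cong maj (addRun-1 r (suc N) T)) (addAt-maj r N s sz r≤T)
  , trans (cong (λ z → rowOf (addAt r z T) z) (+-identityʳ (suc N))) (addAt-rowOf-new r s sz r≤T)
  where
  r≤T : r ≤ length T
  r≤T = subst (r ≤_) (sym (syt-#rows s)) r≤
addRun-maj r (suc k) {μ} {T} {N} s sz r≤ parts =
  trans (addAt-maj r (N + suc k) s′ sz′ r≤T′)
   (trans (cong (maj T′ +_) (trans (cong (λ z → if z <ᵇ r then N + suc k else 0) last-in-r) (if-≮ {r} {r} _ 0 (<-irrefl refl))))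
    (trans (+-identityʳ _) (proj₁ previous)))
  , addAt-rowOf-new r s′ sz′ r≤T′
  where
  T′ : Filling
  T′ = addRun r (suc N) (suc k) T
  previous : maj (addRun r (suc N) (suc k) T) ≡ maj T + (if rowOf T N <ᵇ r then N else 0)
             × rowOf (addRun r (suc N) (suc k) T) (suc N + k) ≡ r
  previous = addRun-maj r k s sz r≤ (λ j j≤k → parts j (m≤n⇒m≤1+n j≤k))
  s′ : IsSYT (incRun r (suc k) μ) T′
  s′ = addRun-SYT r (suc k) s sz (λ j j<k → parts j (<⇒≤ j<k))
  sz′ : size (incRun r (suc k) μ) ≡ N + suc k
  sz′ = trans (size-incRun r (suc k) μ) (cong (_+ suc k) sz)
  r≤T′ : r ≤ length T′
  r≤T′ = subst (r ≤_) (sym (syt-#rows s′)) (≤-trans r≤ (length-incRun-≥ r (suc k) μ))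
  last-in-r : rowOf T′ (N + suc k) ≡ r
  last-in-r = trans (cong (rowOf T′) (+-suc N k)) (proj₂ previous)

almostRect : ℕ → ℕ → ℕ → List ℕ
almostRect L c k = replicate L c ++ [ k ]

size-replicate : ∀ L c → size (replicate L c) ≡ L * c
size-replicate zero    c = refl
size-replicate (suc L) c = cong (c +_) (size-replicate L c)

size-almostRect : ∀ L c k → size (almostRect L c k) ≡ L * c + k
size-almostRect L c k = trans (sum-++ (replicate L c) [ k ]) (cong₂ _+_ (size-replicate L c) (+-identityʳ k))

length-almostRect : ∀ L c k → length (almostRect L c k) ≡ suc L
length-almostRect L c k = trans (length-++ (replicate L c)) (trans (cong (_+ 1) (length-replicate L)) (+-comm L 1))

bAux-snoc : ∀ i xs k → bAux i (xs ∷ʳ k) ≡ bAux i xs + (i + length xs) * k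
bAux-snoc i []       k = trans (+-identityʳ (i * k)) (cong (_* k) (sym (+-identityʳ i)))
bAux-snoc i (x ∷ xs) k =
  trans (cong (i * x +_) (bAux-snoc (suc i) xs k))
   (trans (sym (+-assoc (i * x) _ _)) (cong (λ z → i * x + bAux (suc i) xs + z * k) (sym (+-suc i (length xs)))))

b-almostRect : ∀ L c k → b (almostRect L c k) ≡ b (replicate L c) + L * k
b-almostRect L c k = trans (bAux-snoc 0 (replicate L c) k) (cong (λ z → b (replicate L c) + z * k) (length-replicate L))

replicate-snoc : ∀ L (c : ℕ) → almostRect L c c ≡ replicate (suc L) c
replicate-snoc zero    c = refl
replicate-snoc (suc L) c = cong (c ∷_) (replicate-snoc L c)

b-replicate-suc : ∀ L c → b (replicate (suc L) c) ≡ b (replicate L c) + L * c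
b-replicate-suc L c = trans (cong b (sym (replicate-snoc L c))) (b-almostRect L c c)

incAt-replicate : ∀ L c → incAt L (replicate L c) ≡ almostRect L c 1
incAt-replicate zero    c = refl
incAt-replicate (suc L) c = cong (c ∷_) (incAt-replicate L c)

incAt-almostRect : ∀ L c k → incAt L (almostRect L c k) ≡ almostRect L c (suc k)
incAt-almostRect zero    c k = refl
incAt-almostRect (suc L) c k = cong (c ∷_) (incAt-almostRect L c k)

incRun-replicate : ∀ L c j → incRun L (suc j) (replicate L c) ≡ almostRect L c (suc j)
incRun-replicate L c zero    = incAt-replicate L c
incRun-replicate L c (suc j) = trans (cong (incAt L) (incRun-replicate L c j)) (incAt-almostRect L c (suc j))

replicate-partition : ∀ L c → 1 ≤ c → IsPartition (replicate L c)
replicate-partition L c 1≤c = record { positive = positive L ; decreasing = decreasing L }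
  where
  positive : ∀ L → All (0 <_) (replicate L c)
  positive zero    = []
  positive (suc L) = 1≤c ∷ positive L
  decreasing : ∀ L → Linked _≥_ (replicate L c)
  decreasing zero          = []
  decreasing (suc zero)    = [-]
  decreasing (suc (suc L)) = ≤-refl ∷ decreasing (suc L)

almostRect-partition : ∀ L c k → 1 ≤ k → k ≤ c → IsPartition (almostRect L c k)
almostRect-partition L c k 1≤k k≤c = record { positive = positive L ; decreasing = decreasing L }
  where
  positive : ∀ L → All (0 <_) (almostRect L c k)
  positive zero    = 1≤k ∷ []
  positive (suc L) = ≤-trans 1≤k k≤c ∷ positive L
  decreasing : ∀ L → Linked _≥_ (almostRect L c k)
  decreasing zero          = [-]
  decreasing (suc zero)    = k≤c ∷ [-]
  decreasing (suc (suc L)) = ≤-refl ∷ decreasing (suc L)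

incAt≢[] : ∀ r μ → incAt r μ ≢ []
incAt≢[] zero    []       ()
incAt≢[] zero    (x ∷ xs) ()
incAt≢[] (suc r) []       ()
incAt≢[] (suc r) (x ∷ xs) ()

incAt-almostRect⁻ : ∀ L c μ k → incAt L μ ≡ almostRect L c (suc k) → L ≤ length μ → All (0 <_) μ →
                    (k ≡ 0 × μ ≡ replicate L c) ⊎ (1 ≤ k × μ ≡ almostRect L c k)
incAt-almostRect⁻ zero c []           k eq _ _ = inj₁ (sym (suc-injective (proj₁ (∷-injective eq))) , refl)
incAt-almostRect⁻ zero c (x ∷ [])     k eq _ (p ∷ _) =
  inj₂ (subst (1 ≤_) x≡k p , cong [_] x≡k)
  where
  x≡k : x ≡ k
  x≡k = suc-injective (proj₁ (∷-injective eq))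
incAt-almostRect⁻ zero c (x ∷ y ∷ xs) k eq _ _ with ∷-injective eq
... | _ , ()
incAt-almostRect⁻ (suc L) c (x ∷ xs) k eq (s≤s le) (_ ∷ pos)
  with incAt-almostRect⁻ L c xs k (proj₂ (∷-injective eq)) le pos
... | inj₁ (k≡0 , eq′) = inj₁ (k≡0 , cong₂ _∷_ (proj₁ (∷-injective eq)) eq′)
... | inj₂ (k≥1 , eq′) = inj₂ (k≥1 , cong₂ _∷_ (proj₁ (∷-injective eq)) eq′)

rectangle-corner : ∀ L c r μ → incAt r μ ≡ replicate (suc L) c → r ≤ length μ → Linked _≥_ μ → r ≡ L
rectangle-corner zero    c zero    μ        eq _ _ = refl
rectangle-corner zero    c (suc r) (x ∷ xs) eq _ _ = ⊥-elim (incAt≢[] r xs (proj₂ (∷-injective eq)))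
rectangle-corner (suc L) c zero    []       eq _ _ with ∷-injective eq
... | _ , ()
rectangle-corner (suc L) c zero    (x ∷ xs) eq _ d with ∷-injective eq
... | x+1≡c , xs≡ = ⊥-elim (<-irrefl refl (≤-trans (≤-reflexive x+1≡c) (≤-trans (≤-reflexive (sym c≡y)) (second≤first d))))
  where
  c≡y : at xs 0 ≡ c
  c≡y = cong (λ z → at z 0) xs≡
rectangle-corner (suc L) c (suc r) (x ∷ xs) eq (s≤s le) d =
  cong suc (rectangle-corner L c r xs (proj₂ (∷-injective eq)) le (Linked.tail d))

record LastRowRemoval (L c k : ℕ) (T : Filling) : Set where
  field
    T′       : Filling
    eqT      : T ≡ addAt L (suc (L * c + k)) T′
    maj-step : maj T ≡ maj T′ + (if rowOf T′ (L * c + k) <ᵇ L then L * c + k else 0)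
    smaller  : (k ≡ 0 × IsSYT (replicate L c) T′) ⊎ (1 ≤ k × IsSYT (almostRect L c k) T′)

removeFromLastRow : ∀ L c k {T} → suc k ≤ c → IsSYT (almostRect L c (suc k)) T →
                    rowOf T (suc (L * c + k)) ≡ L → LastRowRemoval L c k T
removeFromLastRow L c k {T} k<c s in-last = record
  { T′ = Removal.T′ R
  ; eqT = subst (λ z → T ≡ addAt z _ (Removal.T′ R)) r≡L (Removal.eqT R)
  ; maj-step = subst (λ z → maj T ≡ maj (Removal.T′ R) + (if rowOf (Removal.T′ R) N′ <ᵇ z then N′ else 0)) r≡L (Removal.maj-step R)
  ; smaller = smaller (incAt-almostRect⁻ L c (Removal.μ R) k eqμ (subst (_≤ length (Removal.μ R)) r≡L (Removal.r≤μ R))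
                        (IsPartition.positive (Removal.part R)))
  }
  where
  N′ : ℕ
  N′ = L * c + k
  R : Removal (almostRect L c (suc k)) T N′
  R = removeLargest N′ (almostRect-partition L c (suc k) (s≤s z≤n) k<c) s (trans (size-almostRect L c (suc k)) (+-suc (L * c) k))
  r≡L : Removal.r R ≡ L
  r≡L = trans (sym (Removal.rowOf-largest R)) in-last
  eqμ : incAt L (Removal.μ R) ≡ almostRect L c (suc k)
  eqμ = subst (λ z → incAt z (Removal.μ R) ≡ _) r≡L (sym (Removal.eqλ R))
  smaller : (k ≡ 0 × Removal.μ R ≡ replicate L c) ⊎ (1 ≤ k × Removal.μ R ≡ almostRect L c k) →
            (k ≡ 0 × IsSYT (replicate L c) (Removal.T′ R)) ⊎ (1 ≤ k × IsSYT (almostRect L c k) (Removal.T′ R))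
  smaller (inj₁ (k≡0 , μ≡)) = inj₁ (k≡0 , subst (λ z → IsSYT z (Removal.T′ R)) μ≡ (Removal.syt R))
  smaller (inj₂ (k≥1 , μ≡)) = inj₂ (k≥1 , subst (λ z → IsSYT z (Removal.T′ R)) μ≡ (Removal.syt R))

-- Let T ∈ SYT(c^L, k) have its largest entry Lc+k in the last row.  Peel off
-- the maximal run Lc+k′+1, …, Lc+k at the end of that row: either it is the
-- whole row, or Lc+k′ lies above it and is a descent.
data Peeled (L c k : ℕ) (T : Filling) : Set where
  whole-row   : (T₀ : Filling) → IsSYT (replicate L c) T₀ →
                T ≡ addRun L (suc (L * c)) k T₀ → maj T ≡ maj T₀ + L * c → Peeled L c k T
  partial-row : (k′ : ℕ) (T′ : Filling) → 1 ≤ k′ → k′ < k → IsSYT (almostRect L c k′) T′ →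
                T ≡ addRun L (suc (L * c + k′)) (k ∸ k′) T′ → maj T ≡ maj T′ + (L * c + k′) → Peeled L c k T

peel-extend : ∀ L c k {T T′} → T ≡ addAt L (suc (L * c + k)) T′ → maj T ≡ maj T′ → Peeled L c k T′ → Peeled L c (suc k) T
peel-extend L c k eqT maj≡ (whole-row T₀ s₀ eq₀ maj₀) =
  whole-row T₀ s₀ (trans eqT (cong (addAt L _) eq₀)) (trans maj≡ maj₀)
peel-extend L c k {T} eqT maj≡ (partial-row k′ T′ k′≥1 k′<k s′ eq′ maj′) =
  partial-row k′ T′ k′≥1 (m<n⇒m<1+n k′<k) s′ eqT′ (trans maj≡ maj′)
  where
  e : ℕ
  e = suc (L * c + k′)
  e+run : e + (k ∸ k′) ≡ suc (L * c + k)
  e+run = cong suc (trans (+-assoc (L * c) k′ (k ∸ k′)) (cong (L * c +_) (m+[n∸m]≡n (<⇒≤ k′<k))))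
  eqT′ : T ≡ addRun L e (suc k ∸ k′) T′
  eqT′ = trans eqT (trans (cong (addAt L (suc (L * c + k))) eq′)
           (sym (trans (cong (λ z → addRun L e z T′) (+-∸-assoc 1 (<⇒≤ k′<k)))
                       (cong (λ z → addAt L z (addRun L e (k ∸ k′) T′)) e+run))))

peel : ∀ L c k → 1 ≤ L → 1 ≤ k → k ≤ c → ∀ {T} → IsSYT (almostRect L c k) T →
       rowOf T (L * c + k) ≡ L → Peeled L c k T
peel L c (suc k) 1≤L _ k<c {T} s in-last with removeFromLastRow L c k k<c s (trans (cong (rowOf T) (sym (+-suc (L * c) k))) in-last)
... | removal with LastRowRemoval.smaller removal
...   | inj₁ (refl , s₀) =
  whole-row T′ s₀ eqT (trans maj-step (cong (maj T′ +_) (trans (if-< _ 0 above) (+-identityʳ _))))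
  where
  open LastRowRemoval removal using (T′; eqT; maj-step)
  N′≥1 : 1 ≤ L * c + 0
  N′≥1 = ≤-trans (≤-trans 1≤L (m≤m*n L c {{ >-nonZero (≤-trans (s≤s z≤n) k<c) }})) (m≤m+n (L * c) 0)
  above : rowOf T′ (L * c + 0) < L
  above = subst (rowOf T′ (L * c + 0) <_) (length-replicate L) (syt-rowOf-< s₀ _ N′≥1 (≤-reflexive (sym (trans (size-replicate L c) (sym (+-identityʳ (L * c)))))))
...   | inj₂ (k≥1 , s′) with rowOf (LastRowRemoval.T′ removal) (L * c + k) <? L
...     | yes above =
  partial-row k T′ k≥1 ≤-refl s′ (trans eqT (sym (trans (cong (λ z → addRun L (suc (L * c + k)) z T′) (m+n∸n≡m 1 k)) (addRun-1 L _ T′))))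
    (trans maj-step (cong (maj T′ +_) (if-< _ 0 above)))
  where open LastRowRemoval removal using (T′; eqT; maj-step)
...     | no not-above =
  peel-extend L c k eqT (trans maj-step (trans (cong (maj T′ +_) (if-≮ _ 0 not-above)) (+-identityʳ _)))
    (peel L c k 1≤L k≥1 (<⇒≤ k<c) s′ in-last′)
  where
  open LastRowRemoval removal using (T′; eqT; maj-step)
  in-last′ : rowOf T′ (L * c + k) ≡ L
  in-last′ = ≤-antisym (≤-pred (subst (rowOf T′ (L * c + k) <_) (length-almostRect L c k)
                         (syt-rowOf-< s′ _ (≤-trans k≥1 (m≤n+m k (L * c))) (≤-reflexive (sym (size-almostRect L c k))))))
                       (≮⇒≥ not-above)

one-row-form : ∀ {c T} → IsSYT (c ∷ []) T → Σ (List ℕ) λ row → T ≡ row ∷ []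
one-row-form {T = row ∷ []}         s = row , refl
one-row-form {T = []}               s with IsSYT.shape s
... | ()
one-row-form {T = row ∷ row₂ ∷ rows} s with IsSYT.shape s
... | ()

one-row-rowOf : ∀ {c T} → IsSYT (c ∷ []) T → ∀ i → 1 ≤ i → i ≤ size (c ∷ []) → rowOf T i ≡ 0
one-row-rowOf s i 1≤i i≤n with one-row-form s
... | row , refl with ∈-++⁻ row (syt-entry-∈ s 1≤i i≤n)
...   | inj₁ p = rowOf-here row [] p
...   | inj₂ ()

one-row-maj : ∀ {c T} → IsSYT (c ∷ []) T → maj T ≡ 0
one-row-maj {T = T} s =
  trans (maj≡majBy T) (majBy-flat-row (rowOf T) _ (λ i 1≤i i≤len → one-row-rowOf s i 1≤i (≤-trans i≤len (≤-reflexive (syt-#entries s)))))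

single-box : ∀ {T} → IsSYT (1 ∷ []) T → T ≡ [ 1 ] ∷ []
single-box s with one-row-form s
... | (x ∷ []) , refl     = cong [_] (↭-singleton-inv (IsSYT.entries s))
... | [] , refl           = ⊥-elim (0≢1 (proj₁ (∷-injective (IsSYT.shape s))))
  where
  0≢1 : 0 ≢ 1
  0≢1 ()
... | (x ∷ y ∷ _) , refl  = ⊥-elim (2+≢1 (proj₁ (∷-injective (IsSYT.shape s))))
  where
  2+≢1 : ∀ {n} → suc (suc n) ≢ 1
  2+≢1 ()

hook-partition : ∀ j → IsPartition (suc j ∷ 1 ∷ [])
hook-partition j = record { positive = s≤s z≤n ∷ s≤s z≤n ∷ [] ; decreasing = s≤s z≤n ∷ [-] }

size-hook : ∀ k → size (suc k ∷ 1 ∷ []) ≡ suc (suc k)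
size-hook k = +-comm (suc k) 1

incAt-hook⁻ : ∀ r μ x → incAt r μ ≡ x ∷ 1 ∷ [] → r ≤ length μ → All (0 <_) μ →
              (r ≡ 0 × 2 ≤ x × μ ≡ pred x ∷ 1 ∷ []) ⊎ (r ≡ 1 × μ ≡ [ x ])
incAt-hook⁻ zero []       x eq _ _ with ∷-injective eq
... | _ , ()
incAt-hook⁻ zero (y ∷ ys) x eq _ (p ∷ _) with ∷-injective eq
... | refl , refl = inj₁ (refl , s≤s p , refl)
incAt-hook⁻ (suc zero) (y ∷ [])     x eq _ _ with ∷-injective eq
... | refl , _ = inj₂ (refl , refl)
incAt-hook⁻ (suc zero) (y ∷ z ∷ zs) x eq _ (_ ∷ p ∷ _) with ∷-injective eq
... | _ , eq₂ = ⊥-elim (<-irrefl refl (≤-trans p (≤-reflexive (suc-injective (proj₁ (∷-injective eq₂))))))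
incAt-hook⁻ (suc (suc r)) (y ∷ z ∷ zs) x eq _ _ with ∷-injective eq
... | _ , eq₂ = ⊥-elim (incAt≢[] r zs (proj₂ (∷-injective eq₂)))
incAt-hook⁻ (suc (suc r)) (y ∷ []) x eq (s≤s ()) _

column₂ : Filling
column₂ = [ 1 ] ∷ [ 2 ] ∷ []

column₂-SYT : IsSYT (1 ∷ 1 ∷ []) column₂
column₂-SYT = record { shape = refl ; entries = ↭-refl ; rowsInc = [-] ∷ [-] ∷ [] ; colsInc = (s≤s (s≤s z≤n) ∷ []) ∷ [-] }

hookTableau : ℕ → Filling
hookTableau k = addRun 0 3 k column₂

hook-parts : ∀ j → IsPartition (incRun 0 j (1 ∷ 1 ∷ []))
hook-parts j = subst IsPartition (sym (shape j)) (hook-partition j)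
  where
  shape : ∀ j → incRun 0 j (1 ∷ 1 ∷ []) ≡ suc j ∷ 1 ∷ []
  shape zero    = refl
  shape (suc j) = cong (incAt 0) (shape j)

hookTableau-SYT : ∀ k → IsSYT (suc k ∷ 1 ∷ []) (hookTableau k)
hookTableau-SYT k = subst (λ z → IsSYT z (hookTableau k)) (shape k) (addRun-SYT 0 k column₂-SYT refl (λ j _ → hook-parts j))
  where
  shape : ∀ k → incRun 0 k (1 ∷ 1 ∷ []) ≡ suc k ∷ 1 ∷ []
  shape zero    = refl
  shape (suc k) = cong (incAt 0) (shape k)

hookTableau-maj : ∀ k → maj (hookTableau k) ≡ 1 × rowOf (hookTableau (suc k)) (3 + k) ≡ 0
hookTableau-maj zero    = refl , proj₂ (addRun-maj 0 0 column₂-SYT refl z≤n (λ j _ → hook-parts j))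
hookTableau-maj (suc k) = proj₁ (addRun-maj 0 k column₂-SYT refl z≤n (λ j _ → hook-parts j))
                        , proj₂ (addRun-maj 0 (suc k) column₂-SYT refl z≤n (λ j _ → hook-parts j))

-- hookTableau k is the only tableau of shape (k+1, 1) with maj 1: remove the
-- largest entry k+2; if it ends the top row recurse, and if it is the box
-- (1, 0) then (for k ≥ 1) k+1 is a descent, so maj ≥ k+1 ≥ 2.
hook-maj-1-unique : ∀ k {T} → IsSYT (suc k ∷ 1 ∷ []) T → maj T ≡ 1 → T ≡ hookTableau k
hook-corner : ∀ k {T} (R : Removal (suc k ∷ 1 ∷ []) T (suc k)) → maj T ≡ 1 →
              (Removal.r R ≡ 0 × 2 ≤ suc k × Removal.μ R ≡ k ∷ 1 ∷ []) ⊎ (Removal.r R ≡ 1 × Removal.μ R ≡ [ suc k ]) →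
              T ≡ hookTableau k

hook-maj-1-unique k {T} s maj≡1 =
  hook-corner k R maj≡1 (incAt-hook⁻ (Removal.r R) (Removal.μ R) (suc k) (sym (Removal.eqλ R)) (Removal.r≤μ R)
                                     (IsPartition.positive (Removal.part R)))
  where
  R : Removal (suc k ∷ 1 ∷ []) T (suc k)
  R = removeLargest (suc k) (hook-partition k) s (size-hook k)

hook-corner zero    R maj≡1 (inj₁ (_ , s≤s () , _))
hook-corner zero    R maj≡1 (inj₂ (r≡1 , μ≡)) =
  trans (subst (λ z → _ ≡ addAt z 2 (Removal.T′ R)) r≡1 (Removal.eqT R))
        (cong (addAt 1 2) (single-box (subst (λ z → IsSYT z (Removal.T′ R)) μ≡ (Removal.syt R))))
hook-corner (suc k) R maj≡1 (inj₁ (r≡0 , _ , μ≡)) =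
  trans (subst (λ z → _ ≡ addAt z _ T′) r≡0 (Removal.eqT R)) (cong (addAt 0 (3 + k)) (hook-maj-1-unique k s′ maj′≡1))
  where
  T′ : Filling
  T′ = Removal.T′ R
  s′ : IsSYT (suc k ∷ 1 ∷ []) T′
  s′ = subst (λ z → IsSYT z T′) μ≡ (Removal.syt R)
  maj′≡1 : maj T′ ≡ 1
  maj′≡1 = trans (sym (+-identityʳ _))
             (trans (sym (subst (λ z → _ ≡ maj T′ + (if rowOf T′ (2 + k) <ᵇ z then 2 + k else 0)) r≡0 (Removal.maj-step R))) maj≡1)
hook-corner (suc k) {T} R maj≡1 (inj₂ (r≡1 , μ≡)) = ⊥-elim (1≢2+k (trans (sym maj≡1) maj≡2+k))
  where
  T′ : Filling
  T′ = Removal.T′ R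
  s′ : IsSYT [ 2 + k ] T′
  s′ = subst (λ z → IsSYT z T′) μ≡ (Removal.syt R)
  maj≡2+k : maj T ≡ 2 + k
  maj≡2+k = trans (subst (λ z → maj T ≡ maj T′ + (if rowOf T′ (2 + k) <ᵇ z then 2 + k else 0)) r≡1 (Removal.maj-step R))
                  (cong₂ (λ u v → u + (if v <ᵇ 1 then 2 + k else 0)) (one-row-maj s′)
                         (one-row-rowOf s′ (2 + k) (s≤s z≤n) (≤-reflexive (sym (+-identityʳ (2 + k))))))
  1≢2+k : 1 ≢ 2 + k
  1≢2+k ()

-- Rectangles: no tableau with maj = b + 1, exactly one with maj = b + 2

-- In a rectangle with at least two rows the largest entry ends the last row.
rectangle-peel : ∀ L c {T} → 1 ≤ c → IsSYT (replicate (suc (suc L)) c) T → Peeled (suc L) c c T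
rectangle-peel L (suc c₀) {T} _ s = peel (suc L) c c (s≤s z≤n) (s≤s z≤n) ≤-refl s′ in-last
  where
  c : ℕ
  c = suc c₀
  s′ : IsSYT (almostRect (suc L) c c) T
  s′ = subst (λ z → IsSYT z T) (sym (replicate-snoc (suc L) c)) s
  R : Removal (replicate (suc (suc L)) c) T (c₀ + suc L * c)
  R = removeLargest (c₀ + suc L * c) (replicate-partition _ c (s≤s z≤n)) s (size-replicate (suc (suc L)) c)
  in-last : rowOf T (suc L * c + c) ≡ suc L
  in-last = trans (cong (rowOf T) (+-comm (suc L * c) c))
              (trans (Removal.rowOf-largest R)
                (rectangle-corner (suc L) c (Removal.r R) (Removal.μ R) (sym (Removal.eqλ R)) (Removal.r≤μ R)
                                  (IsPartition.decreasing (Removal.part R))))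

whole-row-maj : ∀ L c d {T T₀} → maj T ≡ maj T₀ + suc L * c → maj T ≡ b (replicate (suc (suc L)) c) + d →
                maj T₀ ≡ b (replicate (suc L) c) + d
whole-row-maj L c d {T} {T₀} maj₀ e = +-cancelʳ-≡ X _ _ (begin
  maj T₀ + X      ≡⟨ sym maj₀ ⟩
  maj T           ≡⟨ e ⟩
  b (replicate (suc (suc L)) c) + d ≡⟨ cong (_+ d) (b-replicate-suc (suc L) c) ⟩
  B + X + d       ≡⟨ solve 3 (λ B X d → B :+ X :+ d := B :+ d :+ X) refl B X d ⟩
  B + d + X       ∎)
  where
  open ≡-Reasoning
  X B : ℕ
  X = suc L * c
  B = b (replicate (suc L) c)

-- partial row peeled: the lower bound b ≤ maj on (c^L, k′) gives maj T ≥ b + (L+1)k′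
partial-row-bound : ∀ L c k′ {T T′} → 1 ≤ k′ → k′ ≤ c → IsSYT (almostRect L c k′) T′ →
                    maj T ≡ maj T′ + (L * c + k′) → b (replicate (suc L) c) + suc L * k′ ≤ maj T
partial-row-bound L c k′ {T} {T′} 1≤k′ k′≤c s′ maj′ = begin
  b (replicate (suc L) c) + suc L * k′ ≡⟨ cong (_+ suc L * k′) (b-replicate-suc L c) ⟩
  B + L * c + (k′ + L * k′)            ≡⟨ solve 4 (λ B X k m → B :+ X :+ (k :+ m) := (B :+ m) :+ (X :+ k)) refl B (L * c) k′ (L * k′) ⟩
  B + L * k′ + (L * c + k′)            ≡⟨ cong (_+ (L * c + k′)) (sym (b-almostRect L c k′)) ⟩
  b (almostRect L c k′) + (L * c + k′) ≤⟨ +-monoˡ-≤ (L * c + k′) (b≤maj (almostRect-partition L c k′ 1≤k′ k′≤c) s′) ⟩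
  maj T′ + (L * c + k′)                ≡⟨ sym maj′ ⟩
  maj T                                ∎
  where
  open ≤-Reasoning
  B : ℕ
  B = b (replicate L c)

exceeds : ∀ {B m d M} → d < m → B + m ≤ M → M ≡ B + d → ⊥
exceeds {B} d<m B+m≤M M≡B+d = <⇒≱ d<m (+-cancelˡ-≤ B _ _ (subst (B + _ ≤_) M≡B+d B+m≤M))

rectangle-no-b+1 : ∀ L c {T} → 1 ≤ c → IsSYT (replicate (suc L) c) T → maj T ≢ b (replicate (suc L) c) + 1
rectangle-no-b+1 zero c _ s e with trans (sym (one-row-maj s)) e
... | ()
rectangle-no-b+1 (suc L) c {T} 1≤c s e with rectangle-peel L c 1≤c s
... | whole-row T₀ s₀ _ maj₀ = rectangle-no-b+1 L c 1≤c s₀ (whole-row-maj L c 1 {T} {T₀} maj₀ e)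
... | partial-row k′ T′ 1≤k′ k′<c s′ _ maj′ =
  exceeds (+-mono-≤ 1≤k′ (≤-trans 1≤k′ (m≤m+n k′ _))) (partial-row-bound (suc L) c k′ {T} 1≤k′ (<⇒≤ k′<c) s′ maj′) e

-- the unique tableau of shape (c^(L+2)) with maj = b + 2: the hook of shape
-- (c, 1), completed row by row with runs of consecutive entries
rectangleTableau : ℕ → ℕ → Filling
rectangleTableau c zero    = addRun 1 (suc (suc c)) (pred c) (hookTableau (pred c))
rectangleTableau c (suc L) = addRun (suc (suc L)) (suc (suc (suc L) * c)) c (rectangleTableau c L)

b-two-rows : ∀ c → b (c ∷ c ∷ []) ≡ c
b-two-rows c = trans (+-identityʳ (c + 0)) (+-identityʳ c)

rectangle-b+2-unique : ∀ L c {T} → 2 ≤ c → IsSYT (replicate (suc (suc L)) c) T →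
                       maj T ≡ b (replicate (suc (suc L)) c) + 2 → T ≡ rectangleTableau c L
rectangle-b+2-unique L c 2≤c s e = from-peel L (rectangle-peel L c (≤-trans (s≤s z≤n) 2≤c) s) e
  where
  from-peel : ∀ L {T} → Peeled (suc L) c c T → maj T ≡ b (replicate (suc (suc L)) c) + 2 → T ≡ rectangleTableau c L
  -- a whole row: one row less (impossible for a single row, whose maj is 0)
  from-peel zero {T} (whole-row T₀ s₀ _ maj₀) e with trans (sym (one-row-maj s₀)) (whole-row-maj zero c 2 {T} {T₀} maj₀ e)
  ... | ()
  from-peel (suc L) {T} (whole-row T₀ s₀ eq₀ maj₀) e =
    trans eq₀ (cong (addRun (suc (suc L)) _ c) (rectangle-b+2-unique L c 2≤c s₀ (whole-row-maj (suc L) c 2 {T} {T₀} maj₀ e)))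
  -- a partial row of length k′: b + (L+2)k′ ≤ b + 2 forces L = 0 and k′ = 1
  from-peel (suc L) {T} (partial-row k′ T′ 1≤k′ k′<c s′ _ maj′) e =
    ⊥-elim (exceeds (+-mono-≤ 1≤k′ (+-mono-≤ 1≤k′ (≤-trans 1≤k′ (m≤m+n k′ _))))
                    (partial-row-bound (suc (suc L)) c k′ {T} 1≤k′ (<⇒≤ k′<c) s′ maj′) e)
  from-peel zero {T} (partial-row (suc (suc k″)) T′ 1≤k′ k′<c s′ _ maj′) e =
    ⊥-elim (exceeds (+-mono-≤ {2} (s≤s (s≤s z≤n)) (s≤s z≤n)) (partial-row-bound 1 c _ {T} 1≤k′ (<⇒≤ k′<c) s′ maj′) e)
  from-peel zero {T} (partial-row 1 T′ _ k′<c s′ eq′ maj′) e = hook-completion c 2≤c s′ eq′ maj′ e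
    where
    hook-completion : ∀ c′ → 2 ≤ c′ → IsSYT (c′ ∷ 1 ∷ []) T′ → T ≡ addRun 1 (suc (1 * c′ + 1)) (c′ ∸ 1) T′ →
                      maj T ≡ maj T′ + (1 * c′ + 1) → maj T ≡ b (c′ ∷ c′ ∷ []) + 2 → T ≡ rectangleTableau c′ 0
    hook-completion (suc c₀) _ s′ eq′ maj′ e =
      trans eq′ (cong₂ (λ u v → addRun 1 u c₀ v) (cong suc (trans (+-comm (1 * suc c₀) 1) (cong suc (*-identityˡ (suc c₀))))) (hook-maj-1-unique c₀ s′ maj′≡1))
      where
      maj′≡1 : maj T′ ≡ 1
      maj′≡1 = +-cancelʳ-≡ (suc c₀ + 0 + 1) _ _ (trans (sym maj′) (trans e (trans (cong (_+ 2) (b-two-rows (suc c₀)))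
                 (solve 1 (λ c → c :+ con 2 := con 1 :+ (c :+ con 0 :+ con 1)) refl (suc c₀)))))

rectangleTableau-SYT-maj : ∀ L c → 2 ≤ c →
  IsSYT (replicate (suc (suc L)) c) (rectangleTableau c L) × maj (rectangleTableau c L) ≡ b (replicate (suc (suc L)) c) + 2
rectangleTableau-SYT-maj zero (suc (suc c₀)) _ = syt , maj≡
  where
  c : ℕ
  c = suc (suc c₀)
  shape : ∀ j → incRun 1 j (c ∷ 1 ∷ []) ≡ c ∷ suc j ∷ []
  shape zero    = refl
  shape (suc j) = cong (incAt 1) (shape j)
  parts : ∀ j → j ≤ suc c₀ → IsPartition (incRun 1 j (c ∷ 1 ∷ []))
  parts j j≤ = subst IsPartition (sym (shape j))
                 (record { positive = s≤s z≤n ∷ s≤s z≤n ∷ [] ; decreasing = s≤s j≤ ∷ [-] })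
  syt : IsSYT (c ∷ c ∷ []) (rectangleTableau c 0)
  syt = subst (λ z → IsSYT z (rectangleTableau c 0)) (shape (suc c₀))
          (addRun-SYT 1 (suc c₀) (hookTableau-SYT (suc c₀)) (size-hook (suc c₀)) (λ j j<k → parts j (<⇒≤ j<k)))
  maj≡ : maj (rectangleTableau c 0) ≡ b (c ∷ c ∷ []) + 2
  maj≡ = trans (proj₁ (addRun-maj 1 c₀ (hookTableau-SYT (suc c₀)) (size-hook (suc c₀)) (s≤s z≤n) (λ j j≤ → parts j (m≤n⇒m≤1+n j≤))))
          (trans (cong₂ _+_ (proj₁ (hookTableau-maj (suc c₀))) (cong (λ z → if z <ᵇ 1 then suc c else 0) (proj₂ (hookTableau-maj c₀))))
            (trans (+-comm 1 (suc c)) (trans (sym (+-suc c 1)) (cong (_+ 2) (sym (b-two-rows c))))))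
rectangleTableau-SYT-maj _ (suc zero) (s≤s ())
rectangleTableau-SYT-maj (suc L) (suc (suc c₀)) 2≤c = syt , maj≡
  where
  c r N : ℕ
  c = suc (suc c₀)
  r = suc (suc L)
  N = r * c
  previous : IsSYT (replicate r c) (rectangleTableau c L) × maj (rectangleTableau c L) ≡ b (replicate r c) + 2
  previous = rectangleTableau-SYT-maj L c 2≤c
  parts : ∀ j → j ≤ c → IsPartition (incRun r j (replicate r c))
  parts zero    _   = replicate-partition r c (s≤s z≤n)
  parts (suc j) j<c = subst IsPartition (sym (incRun-replicate r c j)) (almostRect-partition r c (suc j) (s≤s z≤n) j<c)
  syt : IsSYT (replicate (suc r) c) (rectangleTableau c (suc L))
  syt = subst (λ z → IsSYT z (rectangleTableau c (suc L))) (trans (incRun-replicate r c (suc c₀)) (replicate-snoc r c))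
          (addRun-SYT r c (proj₁ previous) (size-replicate r c) (λ j j<c → parts j (<⇒≤ j<c)))
  -- the first new entry N+1 opens the last row below N, which lies higher
  N-above : rowOf (rectangleTableau c L) N < r
  N-above = subst (rowOf (rectangleTableau c L) N <_) (length-replicate r)
              (syt-rowOf-< (proj₁ previous) N (s≤s z≤n) (≤-reflexive (sym (size-replicate r c))))
  maj≡ : maj (rectangleTableau c (suc L)) ≡ b (replicate (suc r) c) + 2
  maj≡ = begin
    maj (rectangleTableau c (suc L))                 ≡⟨ proj₁ (addRun-maj r (suc c₀) (proj₁ previous) (size-replicate r c)
                                                                        (≤-reflexive (sym (length-replicate r)))
                                                                        (λ j j≤ → parts j (m≤n⇒m≤1+n j≤))) ⟩
    maj (rectangleTableau c L) + (if rowOf (rectangleTableau c L) N <ᵇ r then N else 0)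
                                                     ≡⟨ cong₂ _+_ (proj₂ previous) (if-< N 0 N-above) ⟩
    b (replicate r c) + 2 + N                        ≡⟨ solve 2 (λ B N → B :+ con 2 :+ N := B :+ N :+ con 2) refl (b (replicate r c)) N ⟩
    b (replicate r c) + N + 2                        ≡⟨ cong (_+ 2) (sym (b-replicate-suc r c)) ⟩
    b (replicate (suc r) c) + 2                      ∎
    where
    open ≡-Reasoning

rectangle-form : ∀ λ′ → IsRectangle λ′ → λ′ ≢ [] → Σ ℕ λ L → Σ ℕ λ c → λ′ ≡ replicate (suc L) c
rectangle-form []           _       ne = ⊥-elim (ne refl)
rectangle-form (x ∷ [])     _       _  = 0 , x , refl
rectangle-form (x ∷ y ∷ xs) (e ∷ l) _  with rectangle-form (y ∷ xs) l (λ ())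
... | L , c , eq = suc L , c , cong₂ _∷_ (trans e (proj₁ (∷-injective eq))) eq

corollary4p2 : (λ′ : List ℕ) → IsPartition λ′ → λ′ ≢ [] →
    (CoeffZero λ′ (b λ′ + 1) ⇔ IsRectangle λ′) ×
    (IsRectangle λ′ → 1 < length λ′ → (∀ c → head λ′ ≡ just c → 1 < c) →
      CoeffOne λ′ (b λ′ + 2))
corollary4p2 λ′ p ne = mk⇔ rectangle-if-no-b+1 no-b+1-if-rectangle , unique-b+2
  where
  rectangle-if-no-b+1 : CoeffZero λ′ (b λ′ + 1) → IsRectangle λ′
  rectangle-if-no-b+1 none with Linked.linked? _≟_ λ′
  ... | yes rect    = rect
  ... | no not-rect with non-rectangle-b+1 λ′ p not-rect
  ...   | T , s , maj≡b+1 = ⊥-elim (none T s maj≡b+1)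

  no-b+1-if-rectangle : IsRectangle λ′ → CoeffZero λ′ (b λ′ + 1)
  no-b+1-if-rectangle rect with rectangle-form λ′ rect ne
  ... | L , c , refl = λ T s → rectangle-no-b+1 L c (All.head (IsPartition.positive p)) s

  unique-b+2 : IsRectangle λ′ → 1 < length λ′ → (∀ c → head λ′ ≡ just c → 1 < c) → CoeffOne λ′ (b λ′ + 2)
  unique-b+2 rect rows cols with rectangle-form λ′ rect ne
  ... | zero  , c , refl = ⊥-elim (<-irrefl refl rows)
  ... | suc L , c , refl =
    rectangleTableau c L , rectangleTableau-SYT-maj L c (cols c refl) ,
    λ T s maj≡b+2 → rectangle-b+2-unique L c (cols c refl) s maj≡b+2
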